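{- Let $n,k$ be powers of $2$ with $1\le k\le n$, and let $\bar x\in\mathbb N^n$. Run the comparator network $bit\_sel^n_k$ on $\bar x$: (1) let $l=n/k$; partition $\bar x$ into $l$ consecutive blocks of size $k$ and sort each block with $oe\_sort^k$, obtaining $B_1,\dots,B_l$; (2) while $l>1$: group the blocks into pairs $\langle B_1,B_2\rangle,\dots,\langle B_{l-1},B_l\rangle$; for each $i\in\{1,3,\dots,l-1\}$ compute $\bar y_i=bit\_split^{2k}(B_i::B_{i+1})$ and $B'_{\lceil i/2\rceil}=bit\_merge^k(left(\bar y_i))$ (the sequences $right(\bar y_i)$ are discarded); set $l=l/2$ and rename $B'_i$ to $B_i$ for $1\le i\le l$. Then $bit\_sel^n_k$ is a selection network: the final block $B_1$ is sorted and coincides with the first $k$ entries of the nonincreasing rearrangement of $\bar x$ (it contains the $k$ largest elements of $\bar x$).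
   Context: A sequence is sorted if it is nonincreasing. $\bar x::\bar y$ denotes concatenation; $left$, $right$ denote first and second halves of an even-length sequence. A comparator $c_{i,j}$ ($i<j$) puts the maximum of the entries at positions $i,j$ into position $i$ and the minimum into position $j$. $oe\_sort^k$ is Batcher's odd-even sorting network on $k$ inputs (its output is sorted for every input). For $m$ even, $split^m$ applies $c_{i,m/2+i}$ for $i=1,\dots,m/2$ and $bit\_split^m$ applies $c_{i,m-i+1}$ for $i=1,\dots,m/2$. For $m$ a power of $2$, Batcher's bitonic merger $bit\_merge^m$ is: no comparators if $m=1$; the comparator $c_{1,2}$ if $m=2$; otherwise $split^m$ followed by $bit\_merge^{m/2}$ on each half. -}

module Defs where

open import Data.Nat using (ℕ; zero; suc; _+_; _*_; _∸_; _^_; _≤_; _≥_; _⊔_; _⊓_; _<ᵇ_)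
open import Data.Bool using (if_then_else_)
open import Data.List using (List; []; _∷_; _++_; map; upTo; take; drop; foldl)
open import Data.Product using (_×_; _,_)
open import Data.List.Relation.Unary.Linked using (Linked)

-- Sequences are lists of naturals; positions are 0-based (paper: 1-based).

Sorted : List ℕ → Set
Sorted = Linked _≥_

-- entry at position i (0 when out of range; only used in range)
get : List ℕ → ℕ → ℕ
get []       _       = 0
get (x ∷ xs) zero    = x
get (x ∷ xs) (suc i) = get xs i

set : List ℕ → ℕ → ℕ → List ℕ
set []       _       v = []
set (x ∷ xs) zero    v = v ∷ xs
set (x ∷ xs) (suc i) v = x ∷ set xs i v

comparator : ℕ × ℕ → List ℕ → List ℕ
comparator (i , j) xs = set (set xs i (get xs i ⊔ get xs j)) j (get xs i ⊓ get xs j)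

Network : Set
Network = List (ℕ × ℕ)

run : Network → List ℕ → List ℕ
run net xs = foldl (λ ys c → comparator c ys) xs net

shift : ℕ → Network → Network
shift d = map (λ { (i , j) → (d + i , d + j) })

split : ℕ → Network
split h = map (λ i → (i , h + i)) (upTo h)

-- bit_split^{2h}: c_{i, 2h-i+1} (1-based), i.e. (i, 2h-1-i) 0-based
bitSplit : ℕ → Network
bitSplit h = map (λ i → (i , (2 * h ∸ 1) ∸ i)) (upTo h)

bitMerge : ℕ → Network
bitMerge zero = []
bitMerge (suc zero) = (0 , 1) ∷ []
bitMerge (suc (suc p)) =
  split (2 ^ suc p) ++ bitMerge (suc p) ++ shift (2 ^ suc p) (bitMerge (suc p))

-- Batcher's odd-even merge of the 2^q entries at positions lo, lo+s, lo+2s, ...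
-- (both halves assumed sorted)
oeMerge : ℕ → ℕ → ℕ → Network
oeMerge lo s zero = []
oeMerge lo s (suc zero) = (lo , lo + s) ∷ []
oeMerge lo s (suc (suc q)) =
  oeMerge lo (2 * s) (suc q) ++ oeMerge (lo + s) (2 * s) (suc q) ++
  map (λ t → (lo + s + 2 * s * t , lo + 2 * s + 2 * s * t)) (upTo (2 ^ suc q ∸ 1))

oeSort : ℕ → ℕ → Network
oeSort lo zero = []
oeSort lo (suc q) = oeSort lo q ++ oeSort (lo + 2 ^ q) q ++ oeMerge lo 1 (suc q)

blocks : ℕ → ℕ → List ℕ → List (List ℕ)
blocks k zero    xs = []
blocks k (suc l) xs = take k xs ∷ blocks k l (drop k xs)

round : ℕ → List (List ℕ) → List (List ℕ)
round b (B ∷ B' ∷ rest) =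
  run (bitMerge b) (take (2 ^ b) (run (bitSplit (2 ^ b)) (B ++ B'))) ∷ round b rest
round b _ = []

iterateRounds : ℕ → ℕ → List (List ℕ) → List (List ℕ)
iterateRounds b zero    Bs = Bs
iterateRounds b (suc r) Bs = iterateRounds b r (round b Bs)

-- bit_sel^n_k with n = 2^a, k = 2^b: returns the list of blocks at the end
-- (l = n/k = 2^(a-b) initially; the loop runs a-b times until l = 1)
bitSel : ℕ → ℕ → List ℕ → List (List ℕ)
bitSel a b xs =
  iterateRounds b (a ∸ b) (map (run (oeSort 0 b)) (blocks (2 ^ b) (2 ^ (a ∸ b)) xs))

-- Zero-one principle. For every threshold t the map x ↦ [t < x] is monotone and fixes 0, so it
-- commutes with comparators and hence with bit_sel; and a list is determined by its threshold
-- images, and is sorted iff all of them are. So it suffices to run bit_sel on 0-1 inputs, where a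
-- sorted block of length k is 1^c 0^(k-c). There oe_sort sorts every block; for sorted blocks with
-- c₁ and c₂ ones the left half of bit_split is the bitonic sequence 1^c₁ 0* 1^c₂ (all ones if
-- c₁ + c₂ ≥ k); and bit_merge sorts bitonic 0-1 sequences, because split leaves two bitonic halves
-- one of which is constant. Hence every round replaces the block counts pairwise by min(c₁ + c₂, k),
-- and the last block is 1^min(Σ,k) 0*, which is what the first k entries of the sorted input look
-- like under every threshold.

module Submission where

open import Defs
open import Data.Nat using (ℕ; zero; suc; _+_; _*_; _∸_; _⊔_; _⊓_; _<_; _≤_; z≤n; s≤s; z<s; _≟_; _<?_; _≤?_; _^_)
open import Data.Nat.Properties
open import Data.Sum using (_⊎_; inj₁; inj₂)
open import Data.Nat.Tactic.RingSolver using (solve-∀)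
open import Algebra.Properties.CommutativeSemigroup +-commutativeSemigroup using () renaming (interchange to +-interchange)
open import Data.List using (List; []; _∷_; length; _++_; map; applyUpTo; upTo; take; drop; replicate)
open import Data.List.Relation.Unary.All as All using (All; []; _∷_)
import Data.List.Relation.Unary.All.Properties as Allₚ
open import Data.Product using (Σ; _×_; _,_; proj₁; proj₂)
open import Function using (_∘_; _∘₂_)
open import Function.Definitions using (Injective)
open import Relation.Binary.Core using (_Preserves_⟶_)
open import Relation.Nullary using (yes; no; contradiction)
open import Relation.Binary.PropositionalEquality
  using (_≡_; _≢_; _≗_; refl; sym; trans; cong; cong₂; cong-app; subst; subst₂; ≢-sym; module ≡-Reasoning)
open import Data.List.Properties
  using (∷-injectiveˡ; ∷-injectiveʳ; map-++; map-∘; map-cong; map-applyUpTo; take-map; drop-map; take++drop≡id;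
         length-++; length-map; length-replicate; length-take; length-drop)
open import Data.Nat.ListAction using (sum)
open import Data.Nat.ListAction.Properties using (sum-++; sum-↭)
open import Data.List.Relation.Binary.Permutation.Propositional using (_↭_)
import Data.List.Relation.Binary.Permutation.Propositional.Properties as ↭ₚ
open import Data.List.Relation.Unary.Linked as Linked using ([]; [-]; _∷_)
import Data.List.Relation.Unary.Linked.Properties as Linkedₚ

step : ℕ → ℕ → ℕ
step zero    i       = 0
step (suc c) zero    = 1
step (suc c) (suc i) = step c i

step-< : ∀ {c i} → i < c → step c i ≡ 1
step-< {suc c} {zero}  _         = refl
step-< {suc c} {suc i} (s≤s i<c) = step-< i<c

step-≥ : ∀ {c i} → c ≤ i → step c i ≡ 0
step-≥ {zero}          _         = refl
step-≥ {suc c} {suc i} (s≤s c≤i) = step-≥ c≤i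

step≤1 : ∀ c i → step c i ≤ 1
step≤1 zero    i       = z≤n
step≤1 (suc c) zero    = s≤s z≤n
step≤1 (suc c) (suc i) = step≤1 c i

step-+ : ∀ k c i → step (k + c) (k + i) ≡ step c i
step-+ zero    c i = refl
step-+ (suc k) c i = step-+ k c i

step-shift : ∀ c h p → step c (h + p) ≡ step (c ∸ h) p
step-shift c       zero    p = refl
step-shift zero    (suc h) p = refl
step-shift (suc c) (suc h) p = step-shift c h p

step-monoˡ : ∀ i → (λ c → step c i) Preserves _≤_ ⟶ _≤_
step-monoˡ i       {zero}          _         = z≤n
step-monoˡ zero    {suc c} {suc d} _         = ≤-refl
step-monoˡ (suc i) {suc c} {suc d} (s≤s c≤d) = step-monoˡ i c≤d

step-suc-≤ : ∀ c t → step c (suc t) ≤ step c t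
step-suc-≤ c t = step-monoˡ (suc t) (n≤1+n c)

step-single : ∀ {x} → x ≤ 1 → x ≡ step (x + 0) 0
step-single z≤n       = refl
step-single (s≤s z≤n) = refl

-- Networks are analysed pointwise, on an assignment of values to all wires; a list xs is seen
-- as the assignment get xs (see get-run).
Wires : Set
Wires = ℕ → ℕ

StepOn : ℕ → ℕ → Wires → Set
StepOn n c F = ∀ i → i < n → F i ≡ step c i

compareᶠ : ℕ × ℕ → Wires → Wires
compareᶠ (i , j) F p with p ≟ i | p ≟ j
... | yes _ | _     = F i ⊔ F j
... | no _  | yes _ = F i ⊓ F j
... | no _  | no _  = F p

runᶠ : Network → Wires → Wires
runᶠ []       F = F
runᶠ (c ∷ cs) F = runᶠ cs (compareᶠ c F)

compareᶠ-max : ∀ i j F → compareᶠ (i , j) F i ≡ F i ⊔ F j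
compareᶠ-max i j F with i ≟ i
... | yes _   = refl
... | no i≢i = contradiction refl i≢i

compareᶠ-min : ∀ i j F → i ≢ j → compareᶠ (i , j) F j ≡ F i ⊓ F j
compareᶠ-min i j F i≢j with j ≟ i | j ≟ j
... | yes j≡i | _       = contradiction (sym j≡i) i≢j
... | no _    | yes _   = refl
... | no _    | no j≢j = contradiction refl j≢j

compareᶠ-other : ∀ i j F p → p ≢ i → p ≢ j → compareᶠ (i , j) F p ≡ F p
compareᶠ-other i j F p p≢i p≢j with p ≟ i | p ≟ j
... | yes p≡i | _       = contradiction p≡i p≢i
... | no _    | yes p≡j = contradiction p≡j p≢j
... | no _    | no _    = refl

compareᶠ-cong : ∀ c {F G} → F ≗ G → compareᶠ c F ≗ compareᶠ c G
compareᶠ-cong (i , j) F≗G p with p ≟ i | p ≟ j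
... | yes _ | _     = cong₂ _⊔_ (F≗G i) (F≗G j)
... | no _  | yes _ = cong₂ _⊓_ (F≗G i) (F≗G j)
... | no _  | no _  = F≗G p

runᶠ-cong : ∀ net {F G} → F ≗ G → runᶠ net F ≗ runᶠ net G
runᶠ-cong []       F≗G = F≗G
runᶠ-cong (c ∷ cs) F≗G = runᶠ-cong cs (compareᶠ-cong c F≗G)

runᶠ-++ : ∀ net net′ F → runᶠ (net ++ net′) F ≡ runᶠ net′ (runᶠ net F)
runᶠ-++ []       net′ F = refl
runᶠ-++ (c ∷ cs) net′ F = runᶠ-++ cs net′ (compareᶠ c F)

relabel : (ℕ → ℕ) → Network → Network
relabel π = map (λ (i , j) → π i , π j)

compareᶠ-relabel : ∀ {π} → Injective _≡_ _≡_ π → ∀ i j F x →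
  compareᶠ (π i , π j) F (π x) ≡ compareᶠ (i , j) (F ∘ π) x
compareᶠ-relabel {π} inj i j F x with x ≟ i | x ≟ j
... | yes refl | _ = compareᶠ-max (π x) (π j) F
... | no x≢i | yes refl = compareᶠ-min (π i) (π x) F (λ e → x≢i (sym (inj e)))
... | no x≢i | no x≢j = compareᶠ-other (π i) (π j) F (π x) (x≢i ∘ inj) (x≢j ∘ inj)

runᶠ-relabel : ∀ {π} → Injective _≡_ _≡_ π → ∀ net F x →
  runᶠ (relabel π net) F (π x) ≡ runᶠ net (F ∘ π) x
runᶠ-relabel inj []             F x = refl
runᶠ-relabel inj ((i , j) ∷ cs) F x =
  trans (runᶠ-relabel inj cs _ x) (runᶠ-cong cs (compareᶠ-relabel inj i j F) x)

runᶠ-relabel-outside : ∀ π x → (∀ i → π i ≢ x) → ∀ net F → runᶠ (relabel π net) F x ≡ F x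
runᶠ-relabel-outside π x x∉π []             F = refl
runᶠ-relabel-outside π x x∉π ((i , j) ∷ cs) F =
  trans (runᶠ-relabel-outside π x x∉π cs _) (compareᶠ-other (π i) (π j) F x (x∉π i ∘ sym) (x∉π j ∘ sym))

parallel : (ℕ → ℕ) → (ℕ → ℕ) → ℕ → Network
parallel α β n = applyUpTo (λ t → α t , β t) n

Disjoint : ℕ → (ℕ → ℕ) → (ℕ → ℕ) → Set
Disjoint n α β = ∀ t t′ → t < n → t′ < n → α t ≢ β t′ × (t ≢ t′ → α t ≢ α t′ × β t ≢ β t′)

record ParallelOutput (n : ℕ) (α β : ℕ → ℕ) (F G : Wires) : Set where
  field
    at-α      : ∀ t → t < n → G (α t) ≡ F (α t) ⊔ F (β t)
    at-β      : ∀ t → t < n → G (β t) ≡ F (α t) ⊓ F (β t)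
    elsewhere : ∀ p → (∀ t → t < n → p ≢ α t × p ≢ β t) → G p ≡ F p

runᶠ-parallel : ∀ n α β → Disjoint n α β → ∀ F → ParallelOutput n α β F (runᶠ (parallel α β n) F)
runᶠ-parallel zero    α β disj F = record { at-α = λ _ (); at-β = λ _ (); elsewhere = λ _ _ → refl }
runᶠ-parallel (suc n) α β disj F = record { at-α = at-α′ ; at-β = at-β′ ; elsewhere = elsewhere′ }
  where
  F′ = compareᶠ (α 0 , β 0) F
  disj′ : Disjoint n (α ∘ suc) (β ∘ suc)
  disj′ t t′ t<n t′<n =
    let (αβ , distinct) = disj (suc t) (suc t′) (s≤s t<n) (s≤s t′<n) in αβ , distinct ∘ (_∘ suc-injective)
  open ParallelOutput (runᶠ-parallel n (α ∘ suc) (β ∘ suc) disj′ F′)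
  first≢later : ∀ t → t < n → (α 0 ≢ α (suc t) × α 0 ≢ β (suc t)) × (β 0 ≢ α (suc t) × β 0 ≢ β (suc t))
  first≢later t t<n =
    let (α0≢βt , distinct) = disj 0 (suc t) z<s (s≤s t<n)
        (α0≢αt , β0≢βt)   = distinct (λ ())
    in (α0≢αt , α0≢βt) , (≢-sym (proj₁ (disj (suc t) 0 (s≤s t<n) z<s)) , β0≢βt)
  F′-α : ∀ t → t < n → F′ (α (suc t)) ≡ F (α (suc t))
  F′-α t t<n = let ((a , _) , (b , _)) = first≢later t t<n in compareᶠ-other _ _ F _ (≢-sym a) (≢-sym b)
  F′-β : ∀ t → t < n → F′ (β (suc t)) ≡ F (β (suc t))
  F′-β t t<n = let ((_ , a) , (_ , b)) = first≢later t t<n in compareᶠ-other _ _ F _ (≢-sym a) (≢-sym b)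
  at-α′ : ∀ t → t < suc n → runᶠ (parallel α β (suc n)) F (α t) ≡ F (α t) ⊔ F (β t)
  at-α′ zero    _         = trans (elsewhere (α 0) (proj₁ ∘₂ first≢later)) (compareᶠ-max (α 0) (β 0) F)
  at-α′ (suc t) (s≤s t<n) = trans (at-α t t<n) (cong₂ _⊔_ (F′-α t t<n) (F′-β t t<n))
  at-β′ : ∀ t → t < suc n → runᶠ (parallel α β (suc n)) F (β t) ≡ F (α t) ⊓ F (β t)
  at-β′ zero    _         = trans (elsewhere (β 0) (proj₂ ∘₂ first≢later))
                                  (compareᶠ-min (α 0) (β 0) F (proj₁ (disj 0 0 z<s z<s)))
  at-β′ (suc t) (s≤s t<n) = trans (at-β t t<n) (cong₂ _⊓_ (F′-α t t<n) (F′-β t t<n))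
  elsewhere′ : ∀ p → (∀ t → t < suc n → p ≢ α t × p ≢ β t) → runᶠ (parallel α β (suc n)) F p ≡ F p
  elsewhere′ p p∉ =
    trans (elsewhere p (λ t t<n → p∉ (suc t) (s≤s t<n))) (compareᶠ-other _ _ F p (proj₁ (p∉ 0 z<s)) (proj₂ (p∉ 0 z<s)))

length-set : ∀ xs i v → length (set xs i v) ≡ length xs
length-set []       i       v = refl
length-set (x ∷ xs) zero    v = refl
length-set (x ∷ xs) (suc i) v = cong suc (length-set xs i v)

get-set-≡ : ∀ xs i v → i < length xs → get (set xs i v) i ≡ v
get-set-≡ (x ∷ xs) zero    v _         = refl
get-set-≡ (x ∷ xs) (suc i) v (s≤s i<n) = get-set-≡ xs i v i<n

get-set-≢ : ∀ xs i v p → p ≢ i → get (set xs i v) p ≡ get xs p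
get-set-≢ []       i       v p       p≢i = refl
get-set-≢ (x ∷ xs) zero    v zero    p≢i = contradiction refl p≢i
get-set-≢ (x ∷ xs) zero    v (suc p) p≢i = refl
get-set-≢ (x ∷ xs) (suc i) v zero    p≢i = refl
get-set-≢ (x ∷ xs) (suc i) v (suc p) p≢i = get-set-≢ xs i v p (p≢i ∘ cong suc)

length-comparator : ∀ c xs → length (comparator c xs) ≡ length xs
length-comparator (i , j) xs = trans (length-set (set xs i (get xs i ⊔ get xs j)) j _) (length-set xs i _)

get-comparator : ∀ i j xs → i < length xs → j < length xs →
  get (comparator (i , j) xs) ≗ compareᶠ (i , j) (get xs)
get-comparator i j xs i<n j<n p with p ≟ i | p ≟ j
... | yes refl | yes refl =
  trans (get-set-≡ (set xs p (get xs p ⊔ get xs p)) p _ (subst (p <_) (sym (length-set xs p _)) j<n))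
        (trans (⊓-idem (get xs p)) (sym (⊔-idem (get xs p))))
... | yes refl | no p≢j =
  trans (get-set-≢ (set xs p (get xs p ⊔ get xs j)) j _ p p≢j) (get-set-≡ xs p _ i<n)
... | no _     | yes refl =
  get-set-≡ (set xs i (get xs i ⊔ get xs p)) p _ (subst (p <_) (sym (length-set xs i _)) j<n)
... | no p≢i   | no p≢j =
  trans (get-set-≢ (set xs i (get xs i ⊔ get xs j)) j _ p p≢j) (get-set-≢ xs i _ p p≢i)

Within : ℕ → Network → Set
Within n = All (λ (i , j) → i < n × j < n)

length-run : ∀ net xs → length (run net xs) ≡ length xs
length-run []       xs = refl
length-run (c ∷ cs) xs = trans (length-run cs (comparator c xs)) (length-comparator c xs)

get-run : ∀ net xs → Within (length xs) net → get (run net xs) ≗ runᶠ net (get xs)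
get-run []             xs []                   p = refl
get-run ((i , j) ∷ cs) xs ((i<n , j<n) ∷ within) p =
  trans (get-run cs _ (subst (λ n → Within n cs) (sym (length-comparator (i , j) xs)) within) p)
        (runᶠ-cong cs (get-comparator i j xs i<n j<n) p)

get-ext : ∀ xs ys → length xs ≡ length ys → (∀ p → p < length xs → get xs p ≡ get ys p) → xs ≡ ys
get-ext []       []       _       _  = refl
get-ext (x ∷ xs) (y ∷ ys) |xs|≡|ys| eq =
  cong₂ _∷_ (eq 0 z<s) (get-ext xs ys (suc-injective |xs|≡|ys|) (λ p p<n → eq (suc p) (s≤s p<n)))

get-++ˡ : ∀ xs ys p → p < length xs → get (xs ++ ys) p ≡ get xs p
get-++ˡ (x ∷ xs) ys zero    _         = refl
get-++ˡ (x ∷ xs) ys (suc p) (s≤s p<n) = get-++ˡ xs ys p p<n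

get-++ʳ : ∀ xs ys p → get (xs ++ ys) (length xs + p) ≡ get ys p
get-++ʳ []       ys p = refl
get-++ʳ (x ∷ xs) ys p = get-++ʳ xs ys p

get-take : ∀ n xs p → p < n → get (take n xs) p ≡ get xs p
get-take (suc n) []       p       _         = refl
get-take (suc n) (x ∷ xs) zero    _         = refl
get-take (suc n) (x ∷ xs) (suc p) (s≤s p<n) = get-take n xs p p<n

get-≤1 : ∀ {xs} → All (_≤ 1) xs → ∀ p → get xs p ≤ 1
get-≤1 []           p       = z≤n
get-≤1 (x≤1 ∷ _)    zero    = x≤1
get-≤1 (_ ∷ xs≤1)   (suc p) = get-≤1 xs≤1 p

-- The zero-one principle

-- f 0 ≡ 0 is needed because get returns 0 outside a list.
module _ {f : ℕ → ℕ} (f-mono : f Preserves _≤_ ⟶ _≤_) (f0≡0 : f 0 ≡ 0) where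

  open ≡-Reasoning

  get-map : ∀ xs i → get (map f xs) i ≡ f (get xs i)
  get-map []       i       = sym f0≡0
  get-map (x ∷ xs) zero    = refl
  get-map (x ∷ xs) (suc i) = get-map xs i

  set-map : ∀ xs i v → set (map f xs) i (f v) ≡ map f (set xs i v)
  set-map []       i       v = refl
  set-map (x ∷ xs) zero    v = refl
  set-map (x ∷ xs) (suc i) v = cong (f x ∷_) (set-map xs i v)

  comparator-map : ∀ c xs → comparator c (map f xs) ≡ map f (comparator c xs)
  comparator-map (i , j) xs = begin
    set (set (map f xs) i (get (map f xs) i ⊔ get (map f xs) j)) j (get (map f xs) i ⊓ get (map f xs) j)
      ≡⟨ cong₂ (λ a b → set (set (map f xs) i (a ⊔ b)) j (a ⊓ b)) (get-map xs i) (get-map xs j) ⟩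
    set (set (map f xs) i (f a ⊔ f b)) j (f a ⊓ f b)
      ≡⟨ cong₂ (λ u v → set (set (map f xs) i u) j v)
               (sym (mono-≤-distrib-⊔ f-mono a b)) (sym (mono-≤-distrib-⊓ f-mono a b)) ⟩
    set (set (map f xs) i (f (a ⊔ b))) j (f (a ⊓ b))
      ≡⟨ cong (λ ys → set ys j (f (a ⊓ b))) (set-map xs i (a ⊔ b)) ⟩
    set (map f (set xs i (a ⊔ b))) j (f (a ⊓ b))
      ≡⟨ set-map (set xs i (a ⊔ b)) j (a ⊓ b) ⟩
    map f (comparator (i , j) xs) ∎
    where
    a = get xs i
    b = get xs j

  run-map : ∀ net xs → run net (map f xs) ≡ map f (run net xs)
  run-map []       xs = refl
  run-map (c ∷ cs) xs = trans (cong (run cs) (comparator-map c xs)) (run-map cs (comparator c xs))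

  blocks-map : ∀ k l xs → blocks k l (map f xs) ≡ map (map f) (blocks k l xs)
  blocks-map k zero    xs = refl
  blocks-map k (suc l) xs =
    cong₂ _∷_ (take-map k xs) (trans (cong (blocks k l) (drop-map k xs)) (blocks-map k l (drop k xs)))

  round-map : ∀ b Bs → round b (map (map f) Bs) ≡ map (map f) (round b Bs)
  round-map b []               = refl
  round-map b (B ∷ [])         = refl
  round-map b (B ∷ B′ ∷ rest) = cong₂ _∷_ merged (round-map b rest)
    where
    merged : run (bitMerge b) (take (2 ^ b) (run (bitSplit (2 ^ b)) (map f B ++ map f B′)))
           ≡ map f (run (bitMerge b) (take (2 ^ b) (run (bitSplit (2 ^ b)) (B ++ B′))))
    merged = begin
      run (bitMerge b) (take (2 ^ b) (run (bitSplit (2 ^ b)) (map f B ++ map f B′)))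
        ≡⟨ cong (λ ys → run (bitMerge b) (take (2 ^ b) (run (bitSplit (2 ^ b)) ys))) (sym (map-++ f B B′)) ⟩
      run (bitMerge b) (take (2 ^ b) (run (bitSplit (2 ^ b)) (map f (B ++ B′))))
        ≡⟨ cong (λ ys → run (bitMerge b) (take (2 ^ b) ys)) (run-map (bitSplit (2 ^ b)) (B ++ B′)) ⟩
      run (bitMerge b) (take (2 ^ b) (map f (run (bitSplit (2 ^ b)) (B ++ B′))))
        ≡⟨ cong (run (bitMerge b)) (take-map (2 ^ b) _) ⟩
      run (bitMerge b) (map f (take (2 ^ b) (run (bitSplit (2 ^ b)) (B ++ B′))))
        ≡⟨ run-map (bitMerge b) _ ⟩
      map f (run (bitMerge b) (take (2 ^ b) (run (bitSplit (2 ^ b)) (B ++ B′)))) ∎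

  iterateRounds-map : ∀ b r Bs → iterateRounds b r (map (map f) Bs) ≡ map (map f) (iterateRounds b r Bs)
  iterateRounds-map b zero    Bs = refl
  iterateRounds-map b (suc r) Bs =
    trans (cong (iterateRounds b r) (round-map b Bs)) (iterateRounds-map b r (round b Bs))

  bitSel-map : ∀ a b xs → bitSel a b (map f xs) ≡ map (map f) (bitSel a b xs)
  bitSel-map a b xs = begin
    iterateRounds b (a ∸ b) (map (run (oeSort 0 b)) (blocks (2 ^ b) (2 ^ (a ∸ b)) (map f xs)))
      ≡⟨ cong (iterateRounds b (a ∸ b) ∘ map (run (oeSort 0 b))) (blocks-map (2 ^ b) (2 ^ (a ∸ b)) xs) ⟩
    iterateRounds b (a ∸ b) (map (run (oeSort 0 b)) (map (map f) Bs))
      ≡⟨ cong (iterateRounds b (a ∸ b)) (sorted-blocks-map Bs) ⟩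
    iterateRounds b (a ∸ b) (map (map f) (map (run (oeSort 0 b)) Bs))
      ≡⟨ iterateRounds-map b (a ∸ b) _ ⟩
    map (map f) (bitSel a b xs) ∎
    where
    Bs = blocks (2 ^ b) (2 ^ (a ∸ b)) xs
    sorted-blocks-map : ∀ Bs → map (run (oeSort 0 b)) (map (map f) Bs) ≡ map (map f) (map (run (oeSort 0 b)) Bs)
    sorted-blocks-map []       = refl
    sorted-blocks-map (B ∷ Bs) = cong₂ _∷_ (run-map (oeSort 0 b) B) (sorted-blocks-map Bs)

threshold : ℕ → ℕ → ℕ
threshold t x = step x t

threshold-mono : ∀ t → threshold t Preserves _≤_ ⟶ _≤_
threshold-mono t = step-monoˡ t

≤-from-thresholds : ∀ {x y} → (∀ t → threshold t x ≤ threshold t y) → x ≤ y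
≤-from-thresholds {x} {y} below with y <? x
... | no y≮x = ≮⇒≥ y≮x
... | yes y<x = contradiction (subst₂ _≤_ (step-< y<x) (step-≥ (≤-refl {y})) (below y)) λ ()

map-threshold-injective : ∀ xs ys → (∀ t → map (threshold t) xs ≡ map (threshold t) ys) → xs ≡ ys
map-threshold-injective []       []       _  = refl
map-threshold-injective []       (y ∷ ys) eq with () ← eq 0
map-threshold-injective (x ∷ xs) []       eq with () ← eq 0
map-threshold-injective (x ∷ xs) (y ∷ ys) eq =
  cong₂ _∷_ (≤-antisym (≤-from-thresholds (≤-reflexive ∘ heads)) (≤-from-thresholds (≤-reflexive ∘ sym ∘ heads)))
            (map-threshold-injective xs ys (∷-injectiveʳ ∘ eq))
  where
  heads : ∀ t → threshold t x ≡ threshold t y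
  heads = ∷-injectiveˡ ∘ eq

sorted-from-thresholds : ∀ xs → (∀ t → Sorted (map (threshold t) xs)) → Sorted xs
sorted-from-thresholds []           _      = []
sorted-from-thresholds (x ∷ [])     _      = [-]
sorted-from-thresholds (x ∷ y ∷ xs) sorted =
  ≤-from-thresholds (Linked.head ∘ sorted) ∷ sorted-from-thresholds (y ∷ xs) (Linked.tail ∘ sorted)

sorted-map : ∀ {f} → f Preserves _≤_ ⟶ _≤_ → ∀ {xs} → Sorted xs → Sorted (map f xs)
sorted-map f-mono = Linkedₚ.map⁺ ∘ Linked.map f-mono

thermometer : ℕ → ℕ → List ℕ
thermometer k c = replicate c 1 ++ replicate (k ∸ c) 0

zeros-sorted : ∀ n → Sorted (replicate n 0)
zeros-sorted zero          = []
zeros-sorted (suc zero)    = [-]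
zeros-sorted (suc (suc n)) = z≤n ∷ zeros-sorted (suc n)

ones-zeros-sorted : ∀ c d → Sorted (replicate c 1 ++ replicate d 0)
ones-zeros-sorted zero          d       = zeros-sorted d
ones-zeros-sorted (suc zero)    zero    = [-]
ones-zeros-sorted (suc zero)    (suc d) = z≤n ∷ zeros-sorted (suc d)
ones-zeros-sorted (suc (suc c)) d       = s≤s z≤n ∷ ones-zeros-sorted (suc c) d

thermometer-sorted : ∀ k c → Sorted (thermometer k c)
thermometer-sorted k c = ones-zeros-sorted c (k ∸ c)

length-thermometer : ∀ k c → c ≤ k → length (thermometer k c) ≡ k
length-thermometer k c c≤k = begin
  length (replicate c 1 ++ replicate (k ∸ c) 0)     ≡⟨ length-++ (replicate c 1) ⟩
  length (replicate c 1) + length (replicate (k ∸ c) 0) ≡⟨ cong₂ _+_ (length-replicate c) (length-replicate (k ∸ c)) ⟩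
  c + (k ∸ c)                                         ≡⟨ m+[n∸m]≡n c≤k ⟩
  k ∎
  where open ≡-Reasoning

get-replicate-0 : ∀ n p → get (replicate n 0) p ≡ 0
get-replicate-0 zero    p       = refl
get-replicate-0 (suc n) zero    = refl
get-replicate-0 (suc n) (suc p) = get-replicate-0 n p

get-thermometer : ∀ k c p → c ≤ k → p < k → get (thermometer k c) p ≡ step c p
get-thermometer k       zero    p       _         _         = get-replicate-0 k p
get-thermometer (suc k) (suc c) zero    _         _         = refl
get-thermometer (suc k) (suc c) (suc p) (s≤s c≤k) (s≤s p<k) = get-thermometer k c p c≤k p<k

take-replicate-0 : ∀ k n → k ≤ n → take k (replicate n 0) ≡ replicate k 0
take-replicate-0 zero    n       _         = refl
take-replicate-0 (suc k) (suc n) (s≤s k≤n) = cong (0 ∷_) (take-replicate-0 k n k≤n)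

take-thermometer : ∀ k n c → k ≤ n → c ≤ n → take k (thermometer n c) ≡ thermometer k (c ⊓ k)
take-thermometer zero    n       c       _         _         = cong (thermometer 0) (sym (⊓-zeroʳ c))
take-thermometer (suc k) n       zero    k≤n       _         = take-replicate-0 (suc k) n k≤n
take-thermometer (suc k) (suc n) (suc c) (s≤s k≤n) (s≤s c≤n) = cong (1 ∷_) (take-thermometer k n c k≤n c≤n)

sum-replicate-0 : ∀ n → sum (replicate n 0) ≡ 0
sum-replicate-0 zero    = refl
sum-replicate-0 (suc n) = sum-replicate-0 n

zeros-after-0 : ∀ zs → Sorted (0 ∷ zs) → zs ≡ replicate (length zs) 0
zeros-after-0 []       _           = refl
zeros-after-0 (_ ∷ zs) (z≤n ∷ sorted) = cong (0 ∷_) (zeros-after-0 zs sorted)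

sorted01≡thermometer : ∀ zs → Sorted zs → All (_≤ 1) zs → zs ≡ thermometer (length zs) (sum zs)
sorted01≡thermometer []                  _      _               = refl
sorted01≡thermometer (suc zero ∷ zs)     sorted (_ ∷ zs≤1)      =
  cong (1 ∷_) (sorted01≡thermometer zs (Linked.tail sorted) zs≤1)
sorted01≡thermometer (suc (suc _) ∷ zs)  _      (s≤s () ∷ _)
sorted01≡thermometer (zero ∷ zs)         sorted _               = begin
  0 ∷ zs                              ≡⟨ cong (0 ∷_) zeros ⟩
  thermometer (suc (length zs)) 0     ≡⟨ cong (thermometer (suc (length zs))) (sym sum≡0) ⟩
  thermometer (suc (length zs)) (sum zs) ∎
  where
  open ≡-Reasoning
  zeros = zeros-after-0 zs sorted
  sum≡0 : sum zs ≡ 0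
  sum≡0 = trans (cong sum zeros) (sum-replicate-0 (length zs))

sum≤length : ∀ {xs} → All (_≤ 1) xs → sum xs ≤ length xs
sum≤length []           = z≤n
sum≤length (x≤1 ∷ xs≤1) = +-mono-≤ x≤1 (sum≤length xs≤1)

sumᶠ : Wires → ℕ → ℕ
sumᶠ F zero    = 0
sumᶠ F (suc n) = F 0 + sumᶠ (F ∘ suc) n

sumᶠ-cong : ∀ n {F G} → (∀ i → i < n → F i ≡ G i) → sumᶠ F n ≡ sumᶠ G n
sumᶠ-cong zero    eq = refl
sumᶠ-cong (suc n) eq = cong₂ _+_ (eq 0 z<s) (sumᶠ-cong n (λ i i<n → eq (suc i) (s≤s i<n)))

sumᶠ-+ : ∀ m n F → sumᶠ F (m + n) ≡ sumᶠ F m + sumᶠ (F ∘ (m +_)) n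
sumᶠ-+ zero    n F = refl
sumᶠ-+ (suc m) n F = trans (cong (F 0 +_) (sumᶠ-+ m n (F ∘ suc))) (sym (+-assoc (F 0) _ _))

sumᶠ-double : ∀ m F → sumᶠ F (2 * m) ≡ sumᶠ F m + sumᶠ (F ∘ (m +_)) m
sumᶠ-double m F = trans (cong (sumᶠ F) (cong (m +_) (+-identityʳ m))) (sumᶠ-+ m m F)

sumᶠ-≤ : ∀ n F → (∀ i → i < n → F i ≤ 1) → sumᶠ F n ≤ n
sumᶠ-≤ zero    F F≤1 = z≤n
sumᶠ-≤ (suc n) F F≤1 = +-mono-≤ (F≤1 0 z<s) (sumᶠ-≤ n (F ∘ suc) (λ i i<n → F≤1 (suc i) (s≤s i<n)))

sumᶠ-pointwise-+ : ∀ n F G → sumᶠ (λ i → F i + G i) n ≡ sumᶠ F n + sumᶠ G n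
sumᶠ-pointwise-+ zero    F G = refl
sumᶠ-pointwise-+ (suc n) F G =
  trans (cong ((F 0 + G 0) +_) (sumᶠ-pointwise-+ n (F ∘ suc) (G ∘ suc))) (+-interchange (F 0) (G 0) _ _)

m⊔n+m⊓n≡m+n : ∀ m n → m ⊔ n + m ⊓ n ≡ m + n
m⊔n+m⊓n≡m+n m n with ≤-total m n
... | inj₁ m≤n = trans (cong₂ _+_ (m≤n⇒m⊔n≡n m≤n) (m≤n⇒m⊓n≡m m≤n)) (+-comm n m)
... | inj₂ n≤m = cong₂ _+_ (m≥n⇒m⊔n≡m n≤m) (m≥n⇒m⊓n≡n n≤m)

sumᶠ-⊔+⊓ : ∀ n F G → sumᶠ (λ i → F i ⊔ G i) n + sumᶠ (λ i → F i ⊓ G i) n ≡ sumᶠ F n + sumᶠ G n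
sumᶠ-⊔+⊓ n F G = begin
  sumᶠ (λ i → F i ⊔ G i) n + sumᶠ (λ i → F i ⊓ G i) n ≡⟨ sumᶠ-pointwise-+ n _ _ ⟨
  sumᶠ (λ i → F i ⊔ G i + F i ⊓ G i) n                 ≡⟨ sumᶠ-cong n (λ i _ → m⊔n+m⊓n≡m+n (F i) (G i)) ⟩
  sumᶠ (λ i → F i + G i) n                             ≡⟨ sumᶠ-pointwise-+ n F G ⟩
  sumᶠ F n + sumᶠ G n ∎
  where open ≡-Reasoning

sumᶠ-step : ∀ n c → c ≤ n → sumᶠ (step c) n ≡ c
sumᶠ-step zero    zero    _         = refl
sumᶠ-step (suc n) zero    _         = sumᶠ-step n zero z≤n
sumᶠ-step (suc n) (suc c) (s≤s c≤n) = cong suc (sumᶠ-step n c c≤n)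

sumᶠ-get : ∀ xs → sumᶠ (get xs) (length xs) ≡ sum xs
sumᶠ-get []       = refl
sumᶠ-get (x ∷ xs) = cong (x +_) (sumᶠ-get xs)

sumᶠ-complement : ∀ n F → (∀ i → i < n → F i ≤ 1) → sumᶠ (λ i → 1 ∸ F i) n ≡ n ∸ sumᶠ F n
sumᶠ-complement zero    F F≤1 = refl
sumᶠ-complement (suc n) F F≤1 with F 0 | F≤1 0 z<s
... | zero     | _ = trans (cong suc (sumᶠ-complement n (F ∘ suc) F∘suc≤1)) (sym (+-∸-assoc 1 (sumᶠ-≤ n (F ∘ suc) F∘suc≤1)))
  where F∘suc≤1 = λ i i<n → F≤1 (suc i) (s≤s i<n)
... | suc zero | _ = sumᶠ-complement n (F ∘ suc) (λ i i<n → F≤1 (suc i) (s≤s i<n))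
... | suc (suc _) | s≤s ()

n≤2*n : ∀ n → n ≤ 2 * n
n≤2*n n = m≤m+n n _

pred< : ∀ {k} → 0 < k → k ∸ 1 < k
pred< {suc k} _ = n<1+n k

2*-mono-< : ∀ {i m} → i < m → 2 * i < 2 * m
2*-mono-< = *-monoʳ-< 2

1+2*-mono-< : ∀ {i m} → i < m → suc (2 * i) < 2 * m
1+2*-mono-< {i} {m} i<m = subst (_≤ 2 * m) (*-suc 2 i) (*-monoʳ-≤ 2 i<m)

h+-mono-< : ∀ {h i} → i < h → h + i < 2 * h
h+-mono-< {h} i<h = +-monoʳ-< h (<-≤-trans i<h (m≤m+n h 0))

suc-<-pred : ∀ {t m} → t < m ∸ 1 → suc t < m
suc-<-pred {m = suc m} t<m∸1 = s≤s t<m∸1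

suc-<⇒<-pred : ∀ {t m} → suc t < m → t < m ∸ 1
suc-<⇒<-pred {m = suc m} (s≤s 1+t<m) = 1+t<m

2*≢1+2* : ∀ i j → 2 * i ≢ suc (2 * j)
2*≢1+2* zero    j       ()
2*≢1+2* (suc i) zero    eq with () ← trans (sym (*-suc 2 i)) eq
2*≢1+2* (suc i) (suc j) eq = 2*≢1+2* i j (suc-injective (suc-injective (begin
  2 + 2 * i      ≡⟨ *-suc 2 i ⟨
  2 * suc i      ≡⟨ eq ⟩
  suc (2 * suc j) ≡⟨ cong suc (*-suc 2 j) ⟩
  3 + 2 * j ∎)))
  where open ≡-Reasoning

data Parity : ℕ → Set where
  even : ∀ i → Parity (2 * i)
  odd  : ∀ i → Parity (suc (2 * i))

parity : ∀ p → Parity p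
parity zero = even 0
parity (suc p) with parity p
... | even i = odd i
... | odd i  = subst Parity (*-suc 2 i) (even (suc i))

halve : ∀ c → Σ ℕ λ r → Σ ℕ λ u → r ≤ 1 × c ≡ r + 2 * u
halve c with parity c
... | even u = 0 , u , z≤n , refl
... | odd u  = 1 , u , s≤s z≤n , refl

r+2u≤2m⇒r+u≤m : ∀ r u m → r ≤ 1 → r + 2 * u ≤ 2 * m → r + u ≤ m
r+2u≤2m⇒r+u≤m zero          u m _ 2u≤2m  = *-cancelˡ-≤ 2 2u≤2m
r+2u≤2m⇒r+u≤m (suc zero)    u m _ 1+2u≤2m = *-cancelˡ-< 2 u m 1+2u≤2m
r+2u≤2m⇒r+u≤m (suc (suc _)) u m (s≤s ()) _

data Half (h : ℕ) : ℕ → Set where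
  first  : ∀ x → x < h → Half h x
  second : ∀ y → y < h → Half h (h + y)

half : ∀ h x → x < 2 * h → Half h x
half h x x<2h with x <? h
... | yes x<h = first x x<h
... | no x≮h = subst (Half h) (m+[n∸m]≡n h≤x) (second (x ∸ h) (subst (x ∸ h <_) 2h∸h≡h (∸-monoˡ-< x<2h h≤x)))
  where
  h≤x = ≮⇒≥ x≮h
  2h∸h≡h : 2 * h ∸ h ≡ h
  2h∸h≡h = trans (m+n∸m≡n h (h + 0)) (+-identityʳ h)

relabel-∘ : ∀ f g net → relabel f (relabel g net) ≡ relabel (f ∘ g) net
relabel-∘ f g net = sym (map-∘ net)

relabel-cong : ∀ {f g} → f ≗ g → ∀ net → relabel f net ≡ relabel g net
relabel-cong f≗g = map-cong (λ (i , j) → cong₂ _,_ (f≗g i) (f≗g j))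

relabel-++ : ∀ π net net′ → relabel π (net ++ net′) ≡ relabel π net ++ relabel π net′
relabel-++ π = map-++ _

shift≡relabel : ∀ d net → shift d net ≡ relabel (d +_) net
shift≡relabel d = map-cong (λ (i , j) → refl)

oeMerge-relabel-suc : ∀ q → (∀ lo s → oeMerge lo s (suc q) ≡ relabel (λ i → lo + s * i) (oeMerge 0 1 (suc q))) →
  ∀ lo s → oeMerge lo s (suc (suc q)) ≡ relabel (λ i → lo + s * i) (oeMerge 0 1 (suc (suc q)))
oeMerge-relabel-suc q IH lo s = begin
  oeMerge lo (2 * s) (suc q) ++ oeMerge (lo + s) (2 * s) (suc q) ++ map final (upTo (2 ^ suc q ∸ 1))
    ≡⟨ cong₂ _++_ (sub-merge lo (2 * s) 0 (lo+2si≡π[2i] lo s))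
                  (cong₂ _++_ (sub-merge (lo + s) (2 * s) 1 (lo+s+2si≡π[1+2i] lo s)) final≡) ⟩
  relabel π M₀ ++ relabel π M₁ ++ relabel π (map final₀ (upTo (2 ^ suc q ∸ 1)))
    ≡⟨ cong (relabel π M₀ ++_) (relabel-++ π M₁ _) ⟨
  relabel π M₀ ++ relabel π (M₁ ++ map final₀ (upTo (2 ^ suc q ∸ 1)))
    ≡⟨ relabel-++ π M₀ _ ⟨
  relabel π (oeMerge 0 1 (suc (suc q))) ∎
  where
  open ≡-Reasoning
  π = λ i → lo + s * i
  M  = oeMerge 0 1 (suc q)
  M₀ = oeMerge 0 2 (suc q)
  M₁ = oeMerge 1 2 (suc q)
  final  = λ t → lo + s + 2 * s * t , lo + 2 * s + 2 * s * t
  final₀ = λ t → suc (2 * t) , 2 + 2 * t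
  lo+2si≡π[2i] : ∀ lo s i → lo + 2 * s * i ≡ lo + s * (0 + 2 * i)
  lo+2si≡π[2i] = solve-∀
  lo+s+2si≡π[1+2i] : ∀ lo s i → lo + s + 2 * s * i ≡ lo + s * (1 + 2 * i)
  lo+s+2si≡π[1+2i] = solve-∀
  lo+2s+2st≡π[2+2t] : ∀ lo s t → lo + 2 * s + 2 * s * t ≡ lo + s * (2 + 2 * t)
  lo+2s+2st≡π[2+2t] = solve-∀
  sub-merge : ∀ lo′ s′ a → (∀ i → lo′ + s′ * i ≡ π (a + 2 * i)) → oeMerge lo′ s′ (suc q) ≡ relabel π (oeMerge a 2 (suc q))
  sub-merge lo′ s′ a eq = begin
    oeMerge lo′ s′ (suc q)                    ≡⟨ IH lo′ s′ ⟩
    relabel (λ i → lo′ + s′ * i) M            ≡⟨ relabel-cong eq M ⟩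
    relabel (π ∘ (λ i → a + 2 * i)) M         ≡⟨ relabel-∘ π _ M ⟨
    relabel π (relabel (λ i → a + 2 * i) M)   ≡⟨ cong (relabel π) (IH a 2) ⟨
    relabel π (oeMerge a 2 (suc q)) ∎
  final≡ : map final (upTo (2 ^ suc q ∸ 1)) ≡ relabel π (map final₀ (upTo (2 ^ suc q ∸ 1)))
  final≡ = trans (map-cong (λ t → cong₂ _,_ (lo+s+2si≡π[1+2i] lo s t) (lo+2s+2st≡π[2+2t] lo s t)) _) (map-∘ _)

oeMerge-relabel : ∀ q lo s → oeMerge lo s q ≡ relabel (λ i → lo + s * i) (oeMerge 0 1 q)
oeMerge-relabel zero          lo s = refl
oeMerge-relabel (suc zero)    lo s = cong (_∷ []) (cong₂ _,_ (sym (lo+s*0≡lo lo s)) (sym (lo+s*1≡lo+s lo s)))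
  where
  lo+s*0≡lo : ∀ lo s → lo + s * 0 ≡ lo
  lo+s*0≡lo = solve-∀
  lo+s*1≡lo+s : ∀ lo s → lo + s * 1 ≡ lo + s
  lo+s*1≡lo+s = solve-∀
oeMerge-relabel (suc (suc q)) = oeMerge-relabel-suc q (oeMerge-relabel (suc q))

oeSort-relabel : ∀ q lo → oeSort lo q ≡ relabel (lo +_) (oeSort 0 q)
oeSort-relabel zero    lo = refl
oeSort-relabel (suc q) lo = begin
  oeSort lo q ++ oeSort (lo + 2 ^ q) q ++ oeMerge lo 1 (suc q)
    ≡⟨ cong₂ _++_ (oeSort-relabel q lo) (cong₂ _++_ right-half merge) ⟩
  relabel (lo +_) S ++ relabel (lo +_) (oeSort (2 ^ q) q) ++ relabel (lo +_) (oeMerge 0 1 (suc q))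
    ≡⟨ cong (relabel (lo +_) S ++_) (relabel-++ (lo +_) (oeSort (2 ^ q) q) _) ⟨
  relabel (lo +_) S ++ relabel (lo +_) (oeSort (2 ^ q) q ++ oeMerge 0 1 (suc q))
    ≡⟨ relabel-++ (lo +_) S _ ⟨
  relabel (lo +_) (oeSort 0 (suc q)) ∎
  where
  open ≡-Reasoning
  S = oeSort 0 q
  right-half : oeSort (lo + 2 ^ q) q ≡ relabel (lo +_) (oeSort (2 ^ q) q)
  right-half = begin
    oeSort (lo + 2 ^ q) q                   ≡⟨ oeSort-relabel q (lo + 2 ^ q) ⟩
    relabel ((lo + 2 ^ q) +_) S             ≡⟨ relabel-cong (+-assoc lo (2 ^ q)) S ⟩
    relabel ((lo +_) ∘ (2 ^ q +_)) S        ≡⟨ relabel-∘ (lo +_) (2 ^ q +_) S ⟨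
    relabel (lo +_) (relabel (2 ^ q +_) S)  ≡⟨ cong (relabel (lo +_)) (oeSort-relabel q (2 ^ q)) ⟨
    relabel (lo +_) (oeSort (2 ^ q) q) ∎
  merge : oeMerge lo 1 (suc q) ≡ relabel (lo +_) (oeMerge 0 1 (suc q))
  merge = trans (oeMerge-relabel (suc q) lo 1) (relabel-cong (λ i → cong (lo +_) (*-identityˡ i)) _)

bitMerge-suc : ∀ p → bitMerge (suc p) ≡ split (2 ^ p) ++ bitMerge p ++ relabel (2 ^ p +_) (bitMerge p)
bitMerge-suc zero    = refl
bitMerge-suc (suc p) = cong (λ net → split (2 ^ suc p) ++ bitMerge (suc p) ++ net) (shift≡relabel _ _)

split≡parallel : ∀ h → split h ≡ parallel (λ t → t) (h +_) h
split≡parallel h = map-applyUpTo _ _ h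

bitSplit≡parallel : ∀ h → bitSplit h ≡ parallel (λ t → t) (λ t → (2 * h ∸ 1) ∸ t) h
bitSplit≡parallel h = map-applyUpTo _ _ h

oeMerge-final≡parallel : ∀ n → map (λ t → suc (2 * t) , 2 + 2 * t) (upTo n) ≡ parallel (λ t → suc (2 * t)) (λ t → 2 + 2 * t) n
oeMerge-final≡parallel n = map-applyUpTo _ _ n

runᶠ-oeMerge-suc : ∀ q F → let M = oeMerge 0 1 (suc q) in
  runᶠ (oeMerge 0 1 (suc (suc q))) F ≡
  runᶠ (parallel (λ t → suc (2 * t)) (λ t → 2 + 2 * t) (2 ^ suc q ∸ 1))
       (runᶠ (relabel (λ i → suc (2 * i)) M) (runᶠ (relabel (2 *_) M) F))
runᶠ-oeMerge-suc q F =
  trans (cong (λ net → runᶠ net F) (cong₂ _++_ (oeMerge-relabel (suc q) 0 2)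
                                              (cong₂ _++_ (oeMerge-relabel (suc q) 1 2) (oeMerge-final≡parallel _))))
        (trans (runᶠ-++ (relabel (2 *_) M) _ F) (runᶠ-++ (relabel (λ i → suc (2 * i)) M) _ _))
  where M = oeMerge 0 1 (suc q)

runᶠ-oeSort-suc : ∀ q F → let S = oeSort 0 q in
  runᶠ (oeSort 0 (suc q)) F ≡ runᶠ (oeMerge 0 1 (suc q)) (runᶠ (relabel (2 ^ q +_) S) (runᶠ S F))
runᶠ-oeSort-suc q F =
  trans (cong (λ net → runᶠ (S ++ net ++ oeMerge 0 1 (suc q)) F) (oeSort-relabel q (2 ^ q)))
        (trans (runᶠ-++ S _ F) (runᶠ-++ (relabel (2 ^ q +_) S) _ _))
  where S = oeSort 0 q

runᶠ-bitMerge-suc : ∀ p F → let h = 2 ^ p; B = bitMerge p in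
  runᶠ (bitMerge (suc p)) F ≡ runᶠ (relabel (h +_) B) (runᶠ B (runᶠ (parallel (λ t → t) (h +_) h) F))
runᶠ-bitMerge-suc p F =
  trans (cong (λ net → runᶠ net F) (trans (bitMerge-suc p) (cong (_++ B ++ relabel (h +_) B) (split≡parallel h))))
        (trans (runᶠ-++ (parallel (λ t → t) (h +_) h) (B ++ relabel (h +_) B) F) (runᶠ-++ B (relabel (h +_) B) _))
  where
  h = 2 ^ p
  B = bitMerge p

runᶠ-outside : ∀ {n} net → Within n net → ∀ F p → n ≤ p → runᶠ net F p ≡ F p
runᶠ-outside []             []                   F p n≤p = refl
runᶠ-outside ((i , j) ∷ cs) ((i<n , j<n) ∷ within) F p n≤p =
  trans (runᶠ-outside cs within _ p n≤p)
        (compareᶠ-other i j F p (λ { refl → <⇒≱ i<n n≤p }) (λ { refl → <⇒≱ j<n n≤p }))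

Within-relabel : ∀ {π m n} → (∀ {i} → i < m → π i < n) → ∀ {net} → Within m net → Within n (relabel π net)
Within-relabel π< = Allₚ.map⁺ ∘ All.map (λ (i<m , j<m) → π< i<m , π< j<m)

Within-≤ : ∀ {m n} → m ≤ n → ∀ {net} → Within m net → Within n net
Within-≤ m≤n = All.map (λ (i<m , j<m) → <-≤-trans i<m m≤n , <-≤-trans j<m m≤n)

Within-parallel : ∀ {n α β} k → (∀ {t} → t < k → α t < n × β t < n) → Within n (parallel α β k)
Within-parallel k bounds = Allₚ.applyUpTo⁺₁ _ k bounds

Within-oeMerge : ∀ q → Within (2 ^ q) (oeMerge 0 1 q)
Within-oeMerge zero          = []
Within-oeMerge (suc zero)    = (z<s , s≤s z<s) ∷ []
Within-oeMerge (suc (suc q)) =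
  Allₚ.++⁺ (subst (Within _) (sym (oeMerge-relabel (suc q) 0 2)) (Within-relabel 2*-mono-< (Within-oeMerge (suc q))))
  (Allₚ.++⁺ (subst (Within _) (sym (oeMerge-relabel (suc q) 1 2)) (Within-relabel 1+2*-mono-< (Within-oeMerge (suc q))))
            (subst (Within _) (sym (oeMerge-final≡parallel (2 ^ suc q ∸ 1))) (Within-parallel _ final<)))
  where
  final< : ∀ {t} → t < 2 ^ suc q ∸ 1 → suc (2 * t) < 2 ^ suc (suc q) × 2 + 2 * t < 2 ^ suc (suc q)
  final< {t} t<m∸1 =
    1+2*-mono-< (<-trans (n<1+n t) 1+t<m) , subst (_< 2 * 2 ^ suc q) (*-suc 2 t) (2*-mono-< 1+t<m)
    where
    1+t<m : suc t < 2 ^ suc q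
    1+t<m = suc-<-pred t<m∸1

Within-oeSort : ∀ q → Within (2 ^ q) (oeSort 0 q)
Within-oeSort zero    = []
Within-oeSort (suc q) =
  Allₚ.++⁺ (Within-≤ (n≤2*n (2 ^ q)) (Within-oeSort q))
  (Allₚ.++⁺ (subst (Within _) (sym (oeSort-relabel q (2 ^ q))) (Within-relabel h+-mono-< (Within-oeSort q)))
            (Within-oeMerge (suc q)))

Within-bitMerge : ∀ p → Within (2 ^ p) (bitMerge p)
Within-bitMerge zero    = []
Within-bitMerge (suc p) = subst (Within _) (sym (bitMerge-suc p))
  (Allₚ.++⁺ (subst (Within _) (sym (split≡parallel (2 ^ p)))
                   (Within-parallel _ (λ t<h → <-≤-trans t<h (n≤2*n _) , h+-mono-< t<h)))
  (Allₚ.++⁺ (Within-≤ (n≤2*n (2 ^ p)) (Within-bitMerge p)) (Within-relabel h+-mono-< (Within-bitMerge p))))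

Within-bitSplit : ∀ h → Within (2 * h) (bitSplit h)
Within-bitSplit h = subst (Within _) (sym (bitSplit≡parallel h)) (Within-parallel h bounds)
  where
  bounds : ∀ {t} → t < h → t < 2 * h × (2 * h ∸ 1) ∸ t < 2 * h
  bounds {t} t<h = <-≤-trans t<h (n≤2*n h) , ≤-<-trans (m∸n≤m _ t) (pred< (<-≤-trans (≤-<-trans z≤n t<h) (n≤2*n h)))

runᶠ-evens-odds : ∀ N N′ F → let G = runᶠ (relabel (λ i → suc (2 * i)) N′) (runᶠ (relabel (2 *_) N) F) in
  (∀ i → G (2 * i) ≡ runᶠ N (F ∘ (2 *_)) i) × (∀ i → G (suc (2 * i)) ≡ runᶠ N′ (F ∘ (λ i → suc (2 * i))) i)
runᶠ-evens-odds N N′ F =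
  (λ i → trans (runᶠ-relabel-outside _ (2 * i) (λ j eq → 2*≢1+2* i j (sym eq)) N′ _)
               (runᶠ-relabel (*-cancelˡ-≡ _ _ 2) N F i)) ,
  (λ i → trans (runᶠ-relabel (*-cancelˡ-≡ _ _ 2 ∘ suc-injective) N′ _ i)
               (runᶠ-cong N′ (λ j → runᶠ-relabel-outside _ (suc (2 * j)) (λ j′ → 2*≢1+2* j′ j) N F) i))

runᶠ-halves : ∀ h N N′ → Within h N → ∀ F → let G = runᶠ (relabel (h +_) N′) (runᶠ N F) in
  (∀ i → i < h → G i ≡ runᶠ N F i) × (∀ i → G (h + i) ≡ runᶠ N′ (F ∘ (h +_)) i)
runᶠ-halves h N N′ within F =
  (λ i i<h → runᶠ-relabel-outside (h +_) i (λ j eq → <⇒≱ i<h (subst (h ≤_) eq (m≤m+n h j))) N′ _) ,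
  (λ i → trans (runᶠ-relabel (+-cancelˡ-≡ h _ _) N′ _ i)
               (runᶠ-cong N′ (λ j → runᶠ-outside N within F (h + j) (m≤m+n h j)) i))

split-disjoint : ∀ h → Disjoint h (λ t → t) (h +_)
split-disjoint h t t′ t<h _ =
  (λ eq → <⇒≱ t<h (subst (h ≤_) (sym eq) (m≤m+n h t′))) , (λ t≢t′ → t≢t′ , t≢t′ ∘ +-cancelˡ-≡ h t t′)

-- Odd-even merge sort on 0-1 inputs

step-2*-2* : ∀ u i → step (2 * u) (2 * i) ≡ step u i
step-2*-2* zero    i       = refl
step-2*-2* (suc u) zero    = refl
step-2*-2* (suc u) (suc i) = trans (cong₂ step (*-suc 2 u) (*-suc 2 i)) (step-2*-2* u i)

step-2*-1+2* : ∀ u i → step (2 * u) (suc (2 * i)) ≡ step u i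
step-2*-1+2* zero    i       = refl
step-2*-1+2* (suc u) zero    = cong (λ c → step c 1) (*-suc 2 u)
step-2*-1+2* (suc u) (suc i) = trans (cong₂ (λ c p → step c (suc p)) (*-suc 2 u) (*-suc 2 i)) (step-2*-1+2* u i)

step-even : ∀ r u i → r ≤ 1 → step (r + 2 * u) (2 * i) ≡ step (r + u) i
step-even zero          u i       _          = step-2*-2* u i
step-even (suc zero)    u zero    _          = refl
step-even (suc zero)    u (suc i) _          = trans (cong (step (suc (2 * u))) (*-suc 2 i)) (step-2*-1+2* u i)
step-even (suc (suc _)) _ _       (s≤s ())

step-odd : ∀ r u i → r ≤ 1 → step (r + 2 * u) (suc (2 * i)) ≡ step u i
step-odd zero          u i _        = step-2*-1+2* u i
step-odd (suc zero)    u i _        = step-2*-2* u i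
step-odd (suc (suc _)) _ _ (s≤s ())

StepOn-evens : ∀ {n r u F} → r ≤ 1 → StepOn (2 * n) (r + 2 * u) F → StepOn n (r + u) (F ∘ (2 *_))
StepOn-evens {r = r} {u} r≤1 F≐ i i<n = trans (F≐ (2 * i) (2*-mono-< i<n)) (step-even r u i r≤1)

StepOn-odds : ∀ {n r u F} → r ≤ 1 → StepOn (2 * n) (r + 2 * u) F → StepOn n u (F ∘ (λ i → suc (2 * i)))
StepOn-odds {r = r} {u} r≤1 F≐ i i<n = trans (F≐ (suc (2 * i)) (1+2*-mono-< i<n)) (step-odd r u i r≤1)

-- Once the even and the odd wires of oe_merge are sorted, wire 2i carries step (δ + o) i and wire
-- 2i+1 carries step o i for some δ ≤ 2; the final comparators (2t+1, 2t+2) turn this into step (δ + 2o).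
interleave-head : ∀ o δ → δ ≤ 2 → step (δ + o) 0 ≡ step (δ + 2 * o) 0
interleave-head o zero       _ = sym (step-2*-2* o 0)
interleave-head o (suc zero) _ = refl
interleave-head o (suc (suc zero)) _ = refl
interleave-head o (suc (suc (suc _))) (s≤s (s≤s ()))

interleave-min : ∀ o δ t → δ ≤ 2 → step o t ⊓ step (δ + o) (suc t) ≡ step (δ + 2 * o) (2 + 2 * t)
interleave-min o zero t _ = begin
  step o t ⊓ step o (suc t) ≡⟨ m≥n⇒m⊓n≡n (step-suc-≤ o t) ⟩
  step o (suc t)            ≡⟨ step-2*-2* o (suc t) ⟨
  step (2 * o) (2 * suc t)  ≡⟨ cong (step (2 * o)) (*-suc 2 t) ⟩
  step (2 * o) (2 + 2 * t)  ∎
  where open ≡-Reasoning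
interleave-min o (suc zero) t _ = trans (⊓-idem (step o t)) (sym (step-2*-1+2* o t))
interleave-min o (suc (suc zero)) t _ = trans (m≤n⇒m⊓n≡m (step-monoˡ t (n≤1+n o))) (sym (step-2*-2* o t))
interleave-min o (suc (suc (suc _))) t (s≤s (s≤s ()))

interleave-max : ∀ o δ t → δ ≤ 2 → step o t ⊔ step (δ + o) (suc t) ≡ step (δ + 2 * o) (suc (2 * t))
interleave-max o zero t _ = trans (m≥n⇒m⊔n≡m (step-suc-≤ o t)) (sym (step-2*-1+2* o t))
interleave-max o (suc zero) t _ = trans (⊔-idem (step o t)) (sym (step-2*-2* o t))
interleave-max o (suc (suc zero)) t _ = trans (m≤n⇒m⊔n≡n (step-monoˡ t (n≤1+n o))) (sym (step-even 1 o t (s≤s z≤n)))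
interleave-max o (suc (suc (suc _))) t (s≤s (s≤s ()))

interleave-last : ∀ o δ t → δ ≤ 2 → δ + o ≤ suc t → step o t ≡ step (δ + 2 * o) (suc (2 * t))
interleave-last o zero t _ _ = sym (step-odd 0 o t z≤n)
interleave-last o (suc zero) t _ _ = sym (step-odd 1 o t (s≤s z≤n))
interleave-last o (suc (suc zero)) t _ (s≤s 1+o≤t) =
  trans (step-≥ (<⇒≤ 1+o≤t)) (sym (trans (step-even 1 o t (s≤s z≤n)) (step-≥ 1+o≤t)))
interleave-last o (suc (suc (suc _))) t (s≤s (s≤s ())) _

module _ (m o δ : ℕ) (G : Wires) (δ≤2 : δ ≤ 2) (δ+o≤m : δ + o ≤ m)
         (evens : StepOn m (δ + o) (G ∘ (2 *_))) (odds : StepOn m o (G ∘ (λ i → suc (2 * i)))) where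

  private
    layer : Network
    layer = parallel (λ t → suc (2 * t)) (λ t → 2 + 2 * t) (m ∸ 1)

    disjoint : Disjoint (m ∸ 1) (λ t → suc (2 * t)) (λ t → 2 + 2 * t)
    disjoint t t′ _ _ = (λ eq → 2*≢1+2* t t′ (suc-injective eq))
                      , (λ t≢t′ → (λ eq → t≢t′ (*-cancelˡ-≡ t t′ 2 (suc-injective eq)))
                                , (λ eq → t≢t′ (*-cancelˡ-≡ t t′ 2 (suc-injective (suc-injective eq)))))

    open ParallelOutput (runᶠ-parallel (m ∸ 1) _ _ disjoint G)
    open ≡-Reasoning

    even-suc : ∀ i → suc i < m → G (2 + 2 * i) ≡ step (δ + o) (suc i)
    even-suc i 1+i<m = trans (cong G (sym (*-suc 2 i))) (evens (suc i) 1+i<m)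

  oeMerge-final-layer : StepOn (2 * m) (δ + 2 * o) (runᶠ layer G)
  oeMerge-final-layer p p<2m with parity p
  ... | even zero = begin
    runᶠ layer G 0  ≡⟨ elsewhere 0 (λ _ _ → (λ ()) , (λ ())) ⟩
    G 0             ≡⟨ evens 0 (*-cancelˡ-< 2 0 m p<2m) ⟩
    step (δ + o) 0  ≡⟨ interleave-head o δ δ≤2 ⟩
    step (δ + 2 * o) 0 ∎
  ... | even (suc t) = begin
    runᶠ layer G (2 * suc t)              ≡⟨ cong (runᶠ layer G) (*-suc 2 t) ⟩
    runᶠ layer G (2 + 2 * t)              ≡⟨ at-β t (suc-<⇒<-pred 1+t<m) ⟩
    G (suc (2 * t)) ⊓ G (2 + 2 * t)        ≡⟨ cong₂ _⊓_ (odds t (<-trans (n<1+n t) 1+t<m)) (even-suc t 1+t<m) ⟩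
    step o t ⊓ step (δ + o) (suc t)       ≡⟨ interleave-min o δ t δ≤2 ⟩
    step (δ + 2 * o) (2 + 2 * t)          ≡⟨ cong (step (δ + 2 * o)) (*-suc 2 t) ⟨
    step (δ + 2 * o) (2 * suc t) ∎
    where 1+t<m = *-cancelˡ-< 2 (suc t) m p<2m
  ... | odd i with i <? m ∸ 1
  ...   | yes i<m∸1 = begin
    runᶠ layer G (suc (2 * i))            ≡⟨ at-α i i<m∸1 ⟩
    G (suc (2 * i)) ⊔ G (2 + 2 * i)        ≡⟨ cong₂ _⊔_ (odds i i<m) (even-suc i (suc-<-pred i<m∸1)) ⟩
    step o i ⊔ step (δ + o) (suc i)       ≡⟨ interleave-max o δ i δ≤2 ⟩
    step (δ + 2 * o) (suc (2 * i)) ∎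
    where i<m = *-cancelˡ-< 2 i m (<-trans (n<1+n _) p<2m)
  ...   | no i≮m∸1 = begin
    runᶠ layer G (suc (2 * i))
      ≡⟨ elsewhere (suc (2 * i)) untouched ⟩
    G (suc (2 * i))
      ≡⟨ odds i (*-cancelˡ-< 2 i m (<-trans (n<1+n _) p<2m)) ⟩
    step o i
      ≡⟨ interleave-last o δ i δ≤2 (≤-trans δ+o≤m (≤-trans (m≤n+m∸n m 1) (s≤s (≮⇒≥ i≮m∸1)))) ⟩
    step (δ + 2 * o) (suc (2 * i)) ∎
    where
    untouched : ∀ t → t < m ∸ 1 → suc (2 * i) ≢ suc (2 * t) × suc (2 * i) ≢ 2 + 2 * t
    untouched t t<m∸1 = (λ eq → i≮m∸1 (subst (_< m ∸ 1) (*-cancelˡ-≡ t i 2 (sym (suc-injective eq))) t<m∸1))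
                      , (λ eq → 2*≢1+2* (suc t) i (trans (*-suc 2 t) (sym eq)))

step-⊔-base : ∀ {c₁ c₂} → c₁ ≤ 1 → c₂ ≤ 1 → step c₁ 0 ⊔ step c₂ 0 ≡ step (c₁ + c₂) 0
step-⊔-base z≤n       z≤n       = refl
step-⊔-base z≤n       (s≤s z≤n) = refl
step-⊔-base (s≤s z≤n) z≤n       = refl
step-⊔-base (s≤s z≤n) (s≤s z≤n) = refl

step-⊓-base : ∀ {c₁ c₂} → c₁ ≤ 1 → c₂ ≤ 1 → step c₁ 0 ⊓ step c₂ 0 ≡ step (c₁ + c₂) 1
step-⊓-base z≤n       z≤n       = refl
step-⊓-base z≤n       (s≤s z≤n) = refl
step-⊓-base (s≤s z≤n) z≤n       = refl
step-⊓-base (s≤s z≤n) (s≤s z≤n) = refl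

OeMerge01 : ℕ → Set
OeMerge01 q = ∀ c₁ c₂ F → c₁ ≤ 2 ^ q → c₂ ≤ 2 ^ q → StepOn (2 ^ q) c₁ F → StepOn (2 ^ q) c₂ (F ∘ (2 ^ q +_)) →
  StepOn (2 * 2 ^ q) (c₁ + c₂) (runᶠ (oeMerge 0 1 (suc q)) F)

oeMerge-01-suc : ∀ q → OeMerge01 q → ∀ r₁ u₁ r₂ u₂ F → r₁ ≤ 1 → r₂ ≤ 1 →
  r₁ + 2 * u₁ ≤ 2 ^ suc q → r₂ + 2 * u₂ ≤ 2 ^ suc q →
  StepOn (2 ^ suc q) (r₁ + 2 * u₁) F → StepOn (2 ^ suc q) (r₂ + 2 * u₂) (F ∘ (2 ^ suc q +_)) →
  StepOn (2 * 2 ^ suc q) (r₁ + 2 * u₁ + (r₂ + 2 * u₂)) (runᶠ (oeMerge 0 1 (suc (suc q))) F)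
oeMerge-01-suc q IH r₁ u₁ r₂ u₂ F r₁≤1 r₂≤1 c₁≤m c₂≤m lower upper p p<2m = begin
  runᶠ (oeMerge 0 1 (suc (suc q))) F p ≡⟨ cong-app (runᶠ-oeMerge-suc q F) p ⟩
  runᶠ layer G p                       ≡⟨ oeMerge-final-layer m o δ G δ≤2 δ+o≤m evens odds p p<2m ⟩
  step (δ + 2 * o) p                   ≡⟨ cong (λ c → step c p) (regroup r₁ u₁ r₂ u₂) ⟩
  step (r₁ + 2 * u₁ + (r₂ + 2 * u₂)) p ∎
  where
  open ≡-Reasoning
  m′ = 2 ^ q
  m  = 2 ^ suc q
  M  = oeMerge 0 1 (suc q)
  layer = parallel (λ t → suc (2 * t)) (λ t → 2 + 2 * t) (m ∸ 1)
  G  = runᶠ (relabel (λ i → suc (2 * i)) M) (runᶠ (relabel (2 *_) M) F)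
  o  = u₁ + u₂
  δ  = r₁ + r₂
  regroup : ∀ r₁ u₁ r₂ u₂ → (r₁ + r₂) + 2 * (u₁ + u₂) ≡ r₁ + 2 * u₁ + (r₂ + 2 * u₂)
  regroup = solve-∀
  e₁≤m′ = r+2u≤2m⇒r+u≤m r₁ u₁ m′ r₁≤1 c₁≤m
  e₂≤m′ = r+2u≤2m⇒r+u≤m r₂ u₂ m′ r₂≤1 c₂≤m
  evens : ∀ i → i < m → G (2 * i) ≡ step (δ + o) i
  evens i i<m = begin
    G (2 * i)
      ≡⟨ proj₁ (runᶠ-evens-odds M M F) i ⟩
    runᶠ M (F ∘ (2 *_)) i
      ≡⟨ IH (r₁ + u₁) (r₂ + u₂) _ e₁≤m′ e₂≤m′ (StepOn-evens {u = u₁} r₁≤1 lower) upper-evens i i<m ⟩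
    step ((r₁ + u₁) + (r₂ + u₂)) i
      ≡⟨ cong (λ c → step c i) (+-interchange r₁ u₁ r₂ u₂) ⟩
    step (δ + o) i ∎
    where
    upper-evens : StepOn m′ (r₂ + u₂) ((F ∘ (2 *_)) ∘ (m′ +_))
    upper-evens j j<m′ = trans (cong F (*-distribˡ-+ 2 m′ j)) (StepOn-evens {u = u₂} r₂≤1 upper j j<m′)
  odds : ∀ i → i < m → G (suc (2 * i)) ≡ step o i
  odds i i<m = trans (proj₂ (runᶠ-evens-odds M M F) i)
    (IH u₁ u₂ _ (≤-trans (m≤n+m u₁ r₁) e₁≤m′) (≤-trans (m≤n+m u₂ r₂) e₂≤m′) (StepOn-odds {u = u₁} r₁≤1 lower) upper-odds i i<m)
    where
    upper-odds : StepOn m′ u₂ ((F ∘ (λ i → suc (2 * i))) ∘ (m′ +_))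
    upper-odds j j<m′ = trans (cong F (trans (cong suc (*-distribˡ-+ 2 m′ j)) (sym (+-suc (2 * m′) (2 * j)))))
                              (StepOn-odds {u = u₂} r₂≤1 upper j j<m′)
  δ≤2 : δ ≤ 2
  δ≤2 = +-mono-≤ r₁≤1 r₂≤1
  δ+o≤m : δ + o ≤ m
  δ+o≤m = subst₂ _≤_ (+-interchange r₁ u₁ r₂ u₂) (cong (m′ +_) (sym (+-identityʳ m′))) (+-mono-≤ e₁≤m′ e₂≤m′)

oeMerge-01 : ∀ q → OeMerge01 q
oeMerge-01 zero c₁ c₂ F c₁≤1 c₂≤1 lower upper zero _ =
  trans (compareᶠ-max 0 1 F) (trans (cong₂ _⊔_ (lower 0 z<s) (upper 0 z<s)) (step-⊔-base c₁≤1 c₂≤1))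
oeMerge-01 zero c₁ c₂ F c₁≤1 c₂≤1 lower upper (suc zero) _ =
  trans (compareᶠ-min 0 1 F (λ ())) (trans (cong₂ _⊓_ (lower 0 z<s) (upper 0 z<s)) (step-⊓-base c₁≤1 c₂≤1))
oeMerge-01 zero _ _ _ _ _ _ _ (suc (suc _)) (s≤s (s≤s ()))
oeMerge-01 (suc q) c₁ c₂ F c₁≤m c₂≤m lower upper with halve c₁ | halve c₂
... | r₁ , u₁ , r₁≤1 , refl | r₂ , u₂ , r₂≤1 , refl =
  oeMerge-01-suc q (oeMerge-01 q) r₁ u₁ r₂ u₂ F r₁≤1 r₂≤1 c₁≤m c₂≤m lower upper

oeSort-01 : ∀ q F → (∀ i → i < 2 ^ q → F i ≤ 1) → StepOn (2 ^ q) (sumᶠ F (2 ^ q)) (runᶠ (oeSort 0 q) F)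
oeSort-01 zero    F F≤1 zero    _           = step-single (F≤1 0 z<s)
oeSort-01 zero    F F≤1 (suc i) (s≤s ())
oeSort-01 (suc q) F F≤1 p p<2m = begin
  runᶠ (oeSort 0 (suc q)) F p                ≡⟨ cong-app (runᶠ-oeSort-suc q F) p ⟩
  runᶠ (oeMerge 0 1 (suc q)) G p             ≡⟨ oeMerge-01 q c₁ c₂ G c₁≤m c₂≤m lower-sorted upper-sorted p p<2m ⟩
  step (c₁ + c₂) p                           ≡⟨ cong (λ c → step c p) (sumᶠ-double m F) ⟨
  step (sumᶠ F (2 * m)) p ∎
  where
  open ≡-Reasoning
  m = 2 ^ q
  S = oeSort 0 q
  G = runᶠ (relabel (m +_) S) (runᶠ S F)
  c₁ = sumᶠ F m
  c₂ = sumᶠ (F ∘ (m +_)) m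
  lower≤1 : ∀ i → i < m → F i ≤ 1
  lower≤1 i i<m = F≤1 i (<-≤-trans i<m (n≤2*n m))
  upper≤1 : ∀ i → i < m → F (m + i) ≤ 1
  upper≤1 i i<m = F≤1 (m + i) (h+-mono-< i<m)
  c₁≤m = sumᶠ-≤ m F lower≤1
  c₂≤m = sumᶠ-≤ m (F ∘ (m +_)) upper≤1
  G-halves = runᶠ-halves m S S (Within-oeSort q) F
  lower-sorted : StepOn m c₁ G
  lower-sorted i i<m = trans (proj₁ G-halves i i<m) (oeSort-01 q F lower≤1 i i<m)
  upper-sorted : StepOn m c₂ (G ∘ (m +_))
  upper-sorted i i<m = trans (proj₂ G-halves i) (oeSort-01 q (F ∘ (m +_)) upper≤1 i i<m)

-- Bitonic merge on 0-1 inputs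

interval : ℕ → ℕ → ℕ → ℕ
interval a e p = step e p ∸ step a p

interval-inside : ∀ {a e p} → a ≤ p → p < e → interval a e p ≡ 1
interval-inside {a} {e} {p} a≤p p<e = cong₂ _∸_ (step-< p<e) (step-≥ a≤p)

interval-below : ∀ {a e p} → p < a → interval a e p ≡ 0
interval-below {a} {e} {p} p<a = trans (cong (step e p ∸_) (step-< p<a)) (m≤n⇒m∸n≡0 (step≤1 e p))

interval-above : ∀ {a e p} → e ≤ p → interval a e p ≡ 0
interval-above {a} {e} {p} e≤p = trans (cong (_∸ step a p) (step-≥ e≤p)) (0∸n≡0 (step a p))

interval≤1 : ∀ a e p → interval a e p ≤ 1
interval≤1 a e p = ≤-trans (m∸n≤m (step e p) (step a p)) (step≤1 e p)

interval-shift : ∀ a e h p → interval a e (h + p) ≡ interval (a ∸ h) (e ∸ h) p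
interval-shift a e h p = cong₂ _∸_ (step-shift e h p) (step-shift a h p)

interval-min-half : ∀ h a e p → interval a e p ⊓ interval a e (h + p) ≡ interval a (e ∸ h) p
interval-min-half h a e p rewrite interval-shift a e h p with p <? a
... | yes p<a =
  trans (cong (_⊓ interval (a ∸ h) (e ∸ h) p) (interval-below {a} {e} p<a)) (sym (interval-below {a} {e ∸ h} p<a))
... | no p≮a with p <? e ∸ h
...   | yes p<e∸h = begin
  interval a e p ⊓ interval (a ∸ h) (e ∸ h) p ≡⟨ cong₂ _⊓_ (interval-inside {a} {e} (≮⇒≥ p≮a) (<-≤-trans p<e∸h (m∸n≤m e h)))
                                                           (interval-inside {a ∸ h} (≤-trans (m∸n≤m a h) (≮⇒≥ p≮a)) p<e∸h) ⟩
  1                                           ≡⟨ interval-inside {a} (≮⇒≥ p≮a) p<e∸h ⟨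
  interval a (e ∸ h) p ∎
  where open ≡-Reasoning
...   | no p≮e∸h =
  trans (cong (interval a e p ⊓_) (interval-above {a ∸ h} (≮⇒≥ p≮e∸h)))
        (trans (⊓-zeroʳ (interval a e p)) (sym (interval-above {a} (≮⇒≥ p≮e∸h))))

-- The bitonic 0-1 sequences 0*1*0* (ones on [a, e)) and 1*0*1*.
data Bitonic (n : ℕ) (F : Wires) : Set where
  hill   : ∀ a e → e ≤ n → (∀ p → p < n → F p ≡ interval a e p) → Bitonic n F
  valley : ∀ a e → e ≤ n → (∀ p → p < n → F p ≡ 1 ∸ interval a e p) → Bitonic n F

Bitonic-cong : ∀ {n F G} → (∀ p → p < n → F p ≡ G p) → Bitonic n G → Bitonic n F
Bitonic-cong F≗G (hill a e e≤n G≗)   = hill a e e≤n (λ p p<n → trans (F≗G p p<n) (G≗ p p<n))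
Bitonic-cong F≗G (valley a e e≤n G≗) = valley a e e≤n (λ p p<n → trans (F≗G p p<n) (G≗ p p<n))

Bitonic-≤1 : ∀ {n F} → Bitonic n F → ∀ p → p < n → F p ≤ 1
Bitonic-≤1 (hill a e _ F≗)   p p<n = ≤-trans (≤-reflexive (F≗ p p<n)) (interval≤1 a e p)
Bitonic-≤1 (valley a e _ F≗) p p<n = ≤-trans (≤-reflexive (F≗ p p<n)) (m∸n≤m 1 (interval a e p))

Bitonic-complement : ∀ {n F} → Bitonic n F → Bitonic n (λ p → 1 ∸ F p)
Bitonic-complement (hill a e e≤n F≗)   = valley a e e≤n (λ p p<n → cong (1 ∸_) (F≗ p p<n))
Bitonic-complement (valley a e e≤n F≗) =
  hill a e e≤n (λ p p<n → trans (cong (1 ∸_) (F≗ p p<n)) (m∸[m∸n]≡n (interval≤1 a e p)))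

Clean : ℕ → Wires → Wires → Set
Clean h M N = (∀ p → p < h → M p ≡ 1) ⊎ (∀ p → p < h → N p ≡ 0)

e≤2h⇒e∸h≤h : ∀ {e h} → e ≤ 2 * h → e ∸ h ≤ h
e≤2h⇒e∸h≤h {e} {h} e≤2h = subst (e ∸ h ≤_) (trans (m+n∸m≡n h (h + 0)) (+-identityʳ h)) (∸-monoˡ-≤ h e≤2h)

valley-max-half : ∀ {h a e} → a ≤ h → h ≤ e → ∀ p → p < h →
  interval a e p ⊔ interval a e (h + p) ≡ 1 ∸ interval (e ∸ h) a p
valley-max-half {h} {a} {e} a≤h h≤e p p<h with p <? e ∸ h | p <? a
... | yes p<e∸h | _ = begin
  interval a e p ⊔ interval a e (h + p)         ≡⟨ cong (interval a e p ⊔_) (interval-shift a e h p) ⟩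
  interval a e p ⊔ interval (a ∸ h) (e ∸ h) p   ≡⟨ cong (interval a e p ⊔_) (interval-inside {a ∸ h} a∸h≤p p<e∸h) ⟩
  interval a e p ⊔ 1                            ≡⟨ m≤n⇒m⊔n≡n (interval≤1 a e p) ⟩
  1                                             ≡⟨ cong (1 ∸_) (interval-below {e ∸ h} {a} p<e∸h) ⟨
  1 ∸ interval (e ∸ h) a p ∎
  where
  open ≡-Reasoning
  a∸h≤p = ≤-trans (≤-reflexive (m≤n⇒m∸n≡0 a≤h)) z≤n
... | no p≮e∸h | yes p<a = begin
  interval a e p ⊔ interval a e (h + p)         ≡⟨ cong₂ _⊔_ (interval-below {a} {e} p<a) (interval-shift a e h p) ⟩
  0 ⊔ interval (a ∸ h) (e ∸ h) p                ≡⟨ interval-above {a ∸ h} (≮⇒≥ p≮e∸h) ⟩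
  0                                             ≡⟨ cong (1 ∸_) (interval-inside {e ∸ h} (≮⇒≥ p≮e∸h) p<a) ⟨
  1 ∸ interval (e ∸ h) a p ∎
  where open ≡-Reasoning
... | no p≮e∸h | no p≮a = begin
  interval a e p ⊔ interval a e (h + p)
    ≡⟨ cong (_⊔ interval a e (h + p)) (interval-inside {a} (≮⇒≥ p≮a) (<-≤-trans p<h h≤e)) ⟩
  1 ⊔ interval a e (h + p)
    ≡⟨ m≥n⇒m⊔n≡m (interval≤1 a e (h + p)) ⟩
  1
    ≡⟨ cong (1 ∸_) (interval-above {e ∸ h} (≮⇒≥ p≮a)) ⟨
  1 ∸ interval (e ∸ h) a p ∎
  where open ≡-Reasoning

interval-max-half : ∀ h a e → e ≤ 2 * h →
  let M = λ p → interval a e p ⊔ interval a e (h + p) in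
  Bitonic h M × Clean h M (λ p → interval a e p ⊓ interval a e (h + p))
interval-max-half h a e e≤2h with h ≤? a
... | yes h≤a = hill (a ∸ h) (e ∸ h) (e≤2h⇒e∸h≤h e≤2h) upper-only , inj₂ min-empty
  where
  upper-only : ∀ p → p < h → interval a e p ⊔ interval a e (h + p) ≡ interval (a ∸ h) (e ∸ h) p
  upper-only p p<h = cong₂ _⊔_ (interval-below {a} {e} (<-≤-trans p<h h≤a)) (interval-shift a e h p)
  min-empty : ∀ p → p < h → interval a e p ⊓ interval a e (h + p) ≡ 0
  min-empty p p<h = trans (interval-min-half h a e p) (interval-below {a} {e ∸ h} (<-≤-trans p<h h≤a))
... | no h≰a with e ≤? h
...   | yes e≤h = hill a e e≤h lower-only , inj₂ min-empty
  where
  lower-only : ∀ p → p < h → interval a e p ⊔ interval a e (h + p) ≡ interval a e p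
  lower-only p _ = trans (cong (interval a e p ⊔_) (interval-above {a} (≤-trans e≤h (m≤m+n h p)))) (⊔-identityʳ _)
  min-empty : ∀ p → p < h → interval a e p ⊓ interval a e (h + p) ≡ 0
  min-empty p _ = trans (interval-min-half h a e p) (interval-above {a} (subst (_≤ p) (sym (m≤n⇒m∸n≡0 e≤h)) z≤n))
...   | no e≰h = valley (e ∸ h) a a≤h (valley-max-half a≤h h≤e) , clean
  where
  a≤h = <⇒≤ (≰⇒> h≰a)
  h≤e = <⇒≤ (≰⇒> e≰h)
  clean : Clean h (λ p → interval a e p ⊔ interval a e (h + p)) (λ p → interval a e p ⊓ interval a e (h + p))
  clean with e ∸ h ≤? a
  ... | yes e∸h≤a = inj₂ λ p _ → trans (interval-min-half h a e p) (empty p)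
    where
    empty : ∀ p → interval a (e ∸ h) p ≡ 0
    empty p with p <? a
    ... | yes p<a = interval-below {a} {e ∸ h} p<a
    ... | no p≮a  = interval-above {a} (≤-trans e∸h≤a (≮⇒≥ p≮a))
  ... | no e∸h≰a = inj₁ λ p p<h → trans (valley-max-half a≤h h≤e p p<h) (cong (1 ∸_) (empty p))
    where
    empty : ∀ p → interval (e ∸ h) a p ≡ 0
    empty p with p <? e ∸ h
    ... | yes p<e∸h = interval-below {e ∸ h} {a} p<e∸h
    ... | no p≮e∸h  = interval-above {e ∸ h} (≤-trans (<⇒≤ (≰⇒> e∸h≰a)) (≮⇒≥ p≮e∸h))

split-interval : ∀ h a e → e ≤ 2 * h →
  let M = λ p → interval a e p ⊔ interval a e (h + p)
      N = λ p → interval a e p ⊓ interval a e (h + p) in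
  Bitonic h M × Bitonic h N × Clean h M N
split-interval h a e e≤2h =
  proj₁ (interval-max-half h a e e≤2h) ,
  hill a (e ∸ h) (e≤2h⇒e∸h≤h e≤2h) (λ p _ → interval-min-half h a e p) ,
  proj₂ (interval-max-half h a e e≤2h)

split-bitonic : ∀ h F → Bitonic (2 * h) F →
  let M = λ p → F p ⊔ F (h + p)
      N = λ p → F p ⊓ F (h + p) in
  Bitonic h M × Bitonic h N × Clean h M N
split-bitonic h F (hill a e e≤2h F≗) with split-interval h a e e≤2h
... | max-bitonic , min-bitonic , clean = Bitonic-cong max≗ max-bitonic , Bitonic-cong min≗ min-bitonic , clean′ clean
  where
  I = interval a e
  max≗ : ∀ p → p < h → F p ⊔ F (h + p) ≡ I p ⊔ I (h + p)
  max≗ p p<h = cong₂ _⊔_ (F≗ p (<-≤-trans p<h (n≤2*n h))) (F≗ (h + p) (h+-mono-< p<h))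
  min≗ : ∀ p → p < h → F p ⊓ F (h + p) ≡ I p ⊓ I (h + p)
  min≗ p p<h = cong₂ _⊓_ (F≗ p (<-≤-trans p<h (n≤2*n h))) (F≗ (h + p) (h+-mono-< p<h))
  clean′ : Clean h (λ p → I p ⊔ I (h + p)) (λ p → I p ⊓ I (h + p)) → Clean h (λ p → F p ⊔ F (h + p)) (λ p → F p ⊓ F (h + p))
  clean′ (inj₁ full)  = inj₁ λ p p<h → trans (max≗ p p<h) (full p p<h)
  clean′ (inj₂ empty) = inj₂ λ p p<h → trans (min≗ p p<h) (empty p p<h)
split-bitonic h F (valley a e e≤2h F≗) with split-interval h a e e≤2h
... | max-bitonic , min-bitonic , clean =
  Bitonic-cong max≗ (Bitonic-complement min-bitonic) , Bitonic-cong min≗ (Bitonic-complement max-bitonic) , clean′ clean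
  where
  I = interval a e
  max≗ : ∀ p → p < h → F p ⊔ F (h + p) ≡ 1 ∸ (I p ⊓ I (h + p))
  max≗ p p<h = trans (cong₂ _⊔_ (F≗ p (<-≤-trans p<h (n≤2*n h))) (F≗ (h + p) (h+-mono-< p<h)))
                     (sym (∸-distribˡ-⊓-⊔ 1 (I p) (I (h + p))))
  min≗ : ∀ p → p < h → F p ⊓ F (h + p) ≡ 1 ∸ (I p ⊔ I (h + p))
  min≗ p p<h = trans (cong₂ _⊓_ (F≗ p (<-≤-trans p<h (n≤2*n h))) (F≗ (h + p) (h+-mono-< p<h)))
                     (sym (∸-distribˡ-⊔-⊓ 1 (I p) (I (h + p))))
  clean′ : Clean h (λ p → I p ⊔ I (h + p)) (λ p → I p ⊓ I (h + p)) → Clean h (λ p → F p ⊔ F (h + p)) (λ p → F p ⊓ F (h + p))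
  clean′ (inj₁ full)  = inj₂ λ p p<h → trans (min≗ p p<h) (cong (1 ∸_) (full p p<h))
  clean′ (inj₂ empty) = inj₁ λ p p<h → trans (max≗ p p<h) (cong (1 ∸_) (empty p p<h))

StepOn-concat : ∀ h c₁ c₂ K → c₁ ≤ h → c₁ ≡ h ⊎ c₂ ≡ 0 →
  StepOn h c₁ K → StepOn h c₂ (K ∘ (h +_)) → StepOn (2 * h) (c₁ + c₂) K
StepOn-concat h c₁ c₂ K c₁≤h clean K-lower K-upper x x<2h with half h x x<2h | clean
... | first  x x<h | inj₁ refl = trans (K-lower x x<h) (trans (step-< x<h) (sym (step-< (<-≤-trans x<h (m≤m+n h c₂)))))
... | first  x x<h | inj₂ refl = trans (K-lower x x<h) (cong (λ c → step c x) (sym (+-identityʳ c₁)))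
... | second y y<h | inj₁ refl = trans (K-upper y y<h) (sym (step-+ h c₂ y))
... | second y y<h | inj₂ refl =
  trans (K-upper y y<h) (sym (step-≥ (≤-trans (≤-reflexive (+-identityʳ c₁)) (≤-trans c₁≤h (m≤m+n h y)))))

bitMerge-01 : ∀ p F → Bitonic (2 ^ p) F → StepOn (2 ^ p) (sumᶠ F (2 ^ p)) (runᶠ (bitMerge p) F)
bitMerge-01 zero    F bitonic zero    _        = step-single (Bitonic-≤1 bitonic 0 z<s)
bitMerge-01 zero    F bitonic (suc _) (s≤s ())
bitMerge-01 (suc p) F bitonic x x<2h = begin
  runᶠ (bitMerge (suc p)) F x ≡⟨ cong-app (runᶠ-bitMerge-suc p F) x ⟩
  K x                         ≡⟨ StepOn-concat h Σ₁ Σ₂ K Σ₁≤h clean-sums K-lower K-upper x x<2h ⟩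
  step (Σ₁ + Σ₂) x            ≡⟨ cong (λ c → step c x) total ⟩
  step (sumᶠ F (2 * h)) x ∎
  where
  open ≡-Reasoning
  h = 2 ^ p
  B = bitMerge p
  G = runᶠ (parallel (λ t → t) (h +_) h) F
  K = runᶠ (relabel (h +_) B) (runᶠ B G)
  open ParallelOutput (runᶠ-parallel h (λ t → t) (h +_) (split-disjoint h) F)
  split-halves = split-bitonic h F bitonic
  G-lower-bitonic : Bitonic h G
  G-lower-bitonic = Bitonic-cong at-α (proj₁ split-halves)
  G-upper-bitonic : Bitonic h (G ∘ (h +_))
  G-upper-bitonic = Bitonic-cong at-β (proj₁ (proj₂ split-halves))
  Σ₁ = sumᶠ G h
  Σ₂ = sumᶠ (G ∘ (h +_)) h
  Σ₁≤h = sumᶠ-≤ h G (Bitonic-≤1 G-lower-bitonic)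
  K-halves = runᶠ-halves h B B (Within-bitMerge p) G
  K-lower : StepOn h Σ₁ K
  K-lower i i<h = trans (proj₁ K-halves i i<h) (bitMerge-01 p G G-lower-bitonic i i<h)
  K-upper : StepOn h Σ₂ (K ∘ (h +_))
  K-upper i i<h = trans (proj₂ K-halves i) (bitMerge-01 p (G ∘ (h +_)) G-upper-bitonic i i<h)
  clean-sums : Σ₁ ≡ h ⊎ Σ₂ ≡ 0
  clean-sums with proj₂ (proj₂ split-halves)
  ... | inj₁ full  = inj₁ (trans (sumᶠ-cong h λ i i<h → trans (at-α i i<h) (trans (full i i<h) (sym (step-< i<h))))
                                 (sumᶠ-step h h ≤-refl))
  ... | inj₂ empty = inj₂ (trans (sumᶠ-cong h λ i i<h → trans (at-β i i<h) (empty i i<h)) (sumᶠ-step h 0 z≤n))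
  total : Σ₁ + Σ₂ ≡ sumᶠ F (2 * h)
  total = begin
    Σ₁ + Σ₂                                                        ≡⟨ cong₂ _+_ (sumᶠ-cong h at-α) (sumᶠ-cong h at-β) ⟩
    sumᶠ (λ i → F i ⊔ F (h + i)) h + sumᶠ (λ i → F i ⊓ F (h + i)) h ≡⟨ sumᶠ-⊔+⊓ h F (F ∘ (h +_)) ⟩
    sumᶠ F h + sumᶠ (F ∘ (h +_)) h                                 ≡⟨ sumᶠ-double h F ⟨
    sumᶠ F (2 * h) ∎

-- bit_sel on 0-1 inputs

run-thermometer : ∀ {n} net xs c → length xs ≡ n → Within n net → c ≤ n →
  StepOn n c (runᶠ net (get xs)) → run net xs ≡ thermometer n c
run-thermometer net xs c refl within c≤n sorted =
  get-ext _ _ (trans (length-run net xs) (sym (length-thermometer _ c c≤n))) λ p p<n →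
    let p<n′ = subst (p <_) (length-run net xs) p<n in
    trans (get-run net xs within p) (trans (sorted p p<n′) (sym (get-thermometer _ c p c≤n p<n′)))

oeSort-thermometer : ∀ b B → length B ≡ 2 ^ b → All (_≤ 1) B → run (oeSort 0 b) B ≡ thermometer (2 ^ b) (sum B)
oeSort-thermometer b B |B|≡2^b B≤1 =
  run-thermometer (oeSort 0 b) B (sum B) |B|≡2^b (Within-oeSort b) sum≤2^b sorted
  where
  sumᶠ≡sum : sumᶠ (get B) (2 ^ b) ≡ sum B
  sumᶠ≡sum = trans (cong (sumᶠ (get B)) (sym |B|≡2^b)) (sumᶠ-get B)
  sum≤2^b : sum B ≤ 2 ^ b
  sum≤2^b = subst (_≤ 2 ^ b) sumᶠ≡sum (sumᶠ-≤ (2 ^ b) (get B) (λ i _ → get-≤1 B≤1 i))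
  sorted : StepOn (2 ^ b) (sum B) (runᶠ (oeSort 0 b) (get B))
  sorted i i<2^b = trans (oeSort-01 b (get B) (λ i _ → get-≤1 B≤1 i) i i<2^b) (cong (λ c → step c i) sumᶠ≡sum)

mirror-index : ∀ k t → t < k → (2 * k ∸ 1) ∸ t ≡ k + ((k ∸ 1) ∸ t)
mirror-index k t t<k with m≤n⇒∃[o]m+o≡n t<k
... | d , refl = begin
  (2 * suc (t + d) ∸ 1) ∸ t        ≡⟨ cong (λ z → (z ∸ 1) ∸ t) (double t d) ⟩
  (t + (suc (t + d) + d)) ∸ t      ≡⟨ m+n∸m≡n t _ ⟩
  suc (t + d) + d                  ≡⟨ cong (suc (t + d) +_) (m+n∸m≡n t d) ⟨
  suc (t + d) + ((t + d) ∸ t) ∎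
  where
  open ≡-Reasoning
  double : ∀ t d → 2 * suc (t + d) ≡ suc (t + (suc (t + d) + d))
  double = solve-∀

step-mirror : ∀ k c t → c ≤ k → t < k → step c ((k ∸ 1) ∸ t) ≡ 1 ∸ step (k ∸ c) t
step-mirror k c t c≤k t<k with m≤n⇒∃[o]m+o≡n t<k
... | d , refl rewrite m+n∸m≡n t d with d <? c
... | yes d<c = trans (step-< d<c) (cong (1 ∸_) (sym (step-≥ k∸c≤t)))
  where
  k∸c≤t : suc (t + d) ∸ c ≤ t
  k∸c≤t = ≤-trans (∸-monoʳ-≤ (suc (t + d)) d<c) (≤-reflexive (m+n∸n≡m t d))
... | no d≮c = trans (step-≥ (≮⇒≥ d≮c)) (cong (1 ∸_) (sym (step-< t<k∸c)))
  where
  t<k∸c : t < suc (t + d) ∸ c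
  t<k∸c = ≤-trans (≤-reflexive (sym (m+n∸n≡m (suc t) d))) (∸-monoʳ-≤ (suc (t + d)) (≮⇒≥ d≮c))

x⊔[1∸y]≡1∸[y∸x] : ∀ {x y} → x ≤ 1 → y ≤ 1 → x ⊔ (1 ∸ y) ≡ 1 ∸ (y ∸ x)
x⊔[1∸y]≡1∸[y∸x] z≤n       z≤n       = refl
x⊔[1∸y]≡1∸[y∸x] z≤n       (s≤s z≤n) = refl
x⊔[1∸y]≡1∸[y∸x] (s≤s z≤n) z≤n       = refl
x⊔[1∸y]≡1∸[y∸x] (s≤s z≤n) (s≤s z≤n) = refl

bitSplit-disjoint : ∀ k → Disjoint k (λ t → t) (λ t → (2 * k ∸ 1) ∸ t)
bitSplit-disjoint k t t′ t<k t′<k =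
  (λ eq → <⇒≱ t<k (subst (k ≤_) (sym (trans eq (mirror-index k t′ t′<k))) (m≤m+n k _))) ,
  (λ t≢t′ → t≢t′ , λ eq → t≢t′ (∸-cancelˡ-≡ (∸-monoˡ-≤ 1 t<k) (∸-monoˡ-≤ 1 t′<k)
    (+-cancelˡ-≡ k _ _ (trans (sym (mirror-index k t t<k)) (trans eq (mirror-index k t′ t′<k))))))

-- That is 1^c₁ 0* 1^c₂ when c₁ + c₂ ≤ k, and all ones otherwise.
bitSplit-left-valley : ∀ k c₁ c₂ → c₁ ≤ k → c₂ ≤ k → ∀ t → t < k →
  get (run (bitSplit k) (thermometer k c₁ ++ thermometer k c₂)) t ≡ 1 ∸ interval c₁ (k ∸ c₂) t
bitSplit-left-valley k c₁ c₂ c₁≤k c₂≤k t t<k = begin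
  get (run (bitSplit k) X) t
    ≡⟨ get-run (bitSplit k) X (subst (λ n → Within n (bitSplit k)) (sym |X|≡2k) (Within-bitSplit k)) t ⟩
  runᶠ (bitSplit k) (get X) t
    ≡⟨ cong (λ net → runᶠ net (get X) t) (bitSplit≡parallel k) ⟩
  runᶠ (parallel (λ t → t) mirror k) (get X) t
    ≡⟨ ParallelOutput.at-α (runᶠ-parallel k _ _ (bitSplit-disjoint k) (get X)) t t<k ⟩
  get X t ⊔ get X (mirror t)
    ≡⟨ cong₂ _⊔_ X-lower X-upper ⟩
  step c₁ t ⊔ (1 ∸ step (k ∸ c₂) t)
    ≡⟨ x⊔[1∸y]≡1∸[y∸x] (step≤1 c₁ t) (step≤1 (k ∸ c₂) t) ⟩
  1 ∸ interval c₁ (k ∸ c₂) t ∎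
  where
  open ≡-Reasoning
  X = thermometer k c₁ ++ thermometer k c₂
  mirror = λ t → (2 * k ∸ 1) ∸ t
  |X|≡2k : length X ≡ 2 * k
  |X|≡2k = trans (length-++ (thermometer k c₁)) (cong₂ _+_ (length-thermometer k c₁ c₁≤k)
                                                         (trans (length-thermometer k c₂ c₂≤k) (sym (+-identityʳ k))))
  X-lower : get X t ≡ step c₁ t
  X-lower = trans (get-++ˡ (thermometer k c₁) _ t (subst (t <_) (sym (length-thermometer k c₁ c₁≤k)) t<k))
                  (get-thermometer k c₁ t c₁≤k t<k)
  X-upper : get X (mirror t) ≡ 1 ∸ step (k ∸ c₂) t
  X-upper = begin
    get X (mirror t)
      ≡⟨ cong (get X) (mirror-index k t t<k) ⟩
    get X (k + ((k ∸ 1) ∸ t))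
      ≡⟨ cong (λ n → get X (n + _)) (length-thermometer k c₁ c₁≤k) ⟨
    get X (length (thermometer k c₁) + ((k ∸ 1) ∸ t))
      ≡⟨ get-++ʳ (thermometer k c₁) _ _ ⟩
    get (thermometer k c₂) ((k ∸ 1) ∸ t)
      ≡⟨ get-thermometer k c₂ _ c₂≤k (≤-<-trans (m∸n≤m _ t) (pred< (≤-<-trans z≤n t<k))) ⟩
    step c₂ ((k ∸ 1) ∸ t)
      ≡⟨ step-mirror k c₂ t c₂≤k t<k ⟩
    1 ∸ step (k ∸ c₂) t ∎

sumᶠ-interval : ∀ n a e → e ≤ n → sumᶠ (interval a e) n ≡ e ∸ a
sumᶠ-interval zero    a       zero    _         = sym (0∸n≡0 a)
sumᶠ-interval (suc n) zero    zero    _         = sumᶠ-interval n 0 0 z≤n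
sumᶠ-interval (suc n) zero    (suc e) (s≤s e≤n) = cong suc (sumᶠ-interval n 0 e e≤n)
sumᶠ-interval (suc n) (suc a) zero    _         = trans (sumᶠ-interval n a 0 z≤n) (trans (0∸n≡0 a) (sym (0∸n≡0 (suc a))))
sumᶠ-interval (suc n) (suc a) (suc e) (s≤s e≤n) = sumᶠ-interval n a e e≤n

m∸[m∸n]≡m⊓n : ∀ m n → m ∸ (m ∸ n) ≡ m ⊓ n
m∸[m∸n]≡m⊓n m n with ≤-total n m
... | inj₁ n≤m = trans (m∸[m∸n]≡n n≤m) (sym (m≥n⇒m⊓n≡n n≤m))
... | inj₂ m≤n = trans (cong (m ∸_) (m≤n⇒m∸n≡0 m≤n)) (sym (m≤n⇒m⊓n≡m m≤n))

round-thermometer : ∀ b c₁ c₂ → c₁ ≤ 2 ^ b → c₂ ≤ 2 ^ b →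
  run (bitMerge b) (take (2 ^ b) (run (bitSplit (2 ^ b)) (thermometer (2 ^ b) c₁ ++ thermometer (2 ^ b) c₂)))
    ≡ thermometer (2 ^ b) ((c₁ + c₂) ⊓ 2 ^ b)
round-thermometer b c₁ c₂ c₁≤k c₂≤k = run-thermometer (bitMerge b) Z _ |Z|≡k (Within-bitMerge b) (m⊓n≤n (c₁ + c₂) k) sorted
  where
  k = 2 ^ b
  X = thermometer k c₁ ++ thermometer k c₂
  Z = take k (run (bitSplit k) X)
  |Z|≡k : length Z ≡ k
  |Z|≡k = begin
    length Z
      ≡⟨ length-take k _ ⟩
    k ⊓ length (run (bitSplit k) X)
      ≡⟨ cong (k ⊓_) (length-run (bitSplit k) X) ⟩
    k ⊓ length X
      ≡⟨ cong (k ⊓_) (length-++ (thermometer k c₁)) ⟩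
    k ⊓ (length (thermometer k c₁) + length (thermometer k c₂))
      ≡⟨ cong (λ n → k ⊓ (n + length (thermometer k c₂))) (length-thermometer k c₁ c₁≤k) ⟩
    k ⊓ (k + length (thermometer k c₂))
      ≡⟨ m≤n⇒m⊓n≡m (m≤m+n k _) ⟩
    k ∎
    where open ≡-Reasoning
  Z-valley : ∀ t → t < k → get Z t ≡ 1 ∸ interval c₁ (k ∸ c₂) t
  Z-valley t t<k = trans (get-take k _ t t<k) (bitSplit-left-valley k c₁ c₂ c₁≤k c₂≤k t t<k)
  Z-bitonic : Bitonic k (get Z)
  Z-bitonic = valley c₁ (k ∸ c₂) (m∸n≤m k c₂) Z-valley
  Z-ones : sumᶠ (get Z) k ≡ (c₁ + c₂) ⊓ k
  Z-ones = begin
    sumᶠ (get Z) k                                ≡⟨ sumᶠ-cong k Z-valley ⟩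
    sumᶠ (λ t → 1 ∸ interval c₁ (k ∸ c₂) t) k     ≡⟨ sumᶠ-complement k _ (λ t _ → interval≤1 c₁ (k ∸ c₂) t) ⟩
    k ∸ sumᶠ (interval c₁ (k ∸ c₂)) k            ≡⟨ cong (k ∸_) (sumᶠ-interval k c₁ (k ∸ c₂) (m∸n≤m k c₂)) ⟩
    k ∸ ((k ∸ c₂) ∸ c₁)                           ≡⟨ cong (k ∸_) (∸-+-assoc k c₂ c₁) ⟩
    k ∸ (k ∸ (c₂ + c₁))                           ≡⟨ m∸[m∸n]≡m⊓n k (c₂ + c₁) ⟩
    k ⊓ (c₂ + c₁)                                 ≡⟨ ⊓-comm k _ ⟩
    (c₂ + c₁) ⊓ k                                 ≡⟨ cong (_⊓ k) (+-comm c₂ c₁) ⟩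
    (c₁ + c₂) ⊓ k ∎
    where open ≡-Reasoning
  sorted : StepOn k ((c₁ + c₂) ⊓ k) (runᶠ (bitMerge b) (get Z))
  sorted i i<k = trans (bitMerge-01 b (get Z) Z-bitonic i i<k) (cong (λ c → step c i) Z-ones)

merge-counts : ℕ → List ℕ → List ℕ
merge-counts k (c₁ ∷ c₂ ∷ cs) = (c₁ + c₂) ⊓ k ∷ merge-counts k cs
merge-counts k _              = []

round-thermometers : ∀ b cs → All (_≤ 2 ^ b) cs →
  round b (map (thermometer (2 ^ b)) cs) ≡ map (thermometer (2 ^ b)) (merge-counts (2 ^ b) cs)
round-thermometers b []             _                   = refl
round-thermometers b (c ∷ [])       _                   = refl
round-thermometers b (c₁ ∷ c₂ ∷ cs) (c₁≤k ∷ c₂≤k ∷ cs≤k) =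
  cong₂ _∷_ (round-thermometer b c₁ c₂ c₁≤k c₂≤k) (round-thermometers b cs cs≤k)

merge-counts-≤ : ∀ k cs → All (_≤ k) (merge-counts k cs)
merge-counts-≤ k []             = []
merge-counts-≤ k (c ∷ [])       = []
merge-counts-≤ k (c₁ ∷ c₂ ∷ cs) = m⊓n≤n (c₁ + c₂) k ∷ merge-counts-≤ k cs

length-merge-counts : ∀ k m cs → length cs ≡ 2 * m → length (merge-counts k cs) ≡ m
length-merge-counts k zero    []             _  = refl
length-merge-counts k (suc m) (c₁ ∷ c₂ ∷ cs) eq =
  cong suc (length-merge-counts k m cs (suc-injective (suc-injective (trans eq (*-suc 2 m)))))
length-merge-counts k (suc m) []             eq with () ← trans eq (*-suc 2 m)
length-merge-counts k (suc m) (c ∷ [])       eq with () ← trans eq (*-suc 2 m)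

[m⊓o+n]⊓o≡[m+n]⊓o : ∀ m n o → (m ⊓ o + n) ⊓ o ≡ (m + n) ⊓ o
[m⊓o+n]⊓o≡[m+n]⊓o m n o with ≤-total m o
... | inj₁ m≤o = cong (λ x → (x + n) ⊓ o) (m≤n⇒m⊓n≡m m≤o)
... | inj₂ o≤m = trans (cong (λ x → (x + n) ⊓ o) (m≥n⇒m⊓n≡n o≤m))
                       (trans (m≥n⇒m⊓n≡n (m≤m+n o n)) (sym (m≥n⇒m⊓n≡n (≤-trans o≤m (m≤m+n m n)))))

[m+n⊓o]⊓o≡[m+n]⊓o : ∀ m n o → (m + n ⊓ o) ⊓ o ≡ (m + n) ⊓ o
[m+n⊓o]⊓o≡[m+n]⊓o m n o = trans (cong (_⊓ o) (+-comm m _)) (trans ([m⊓o+n]⊓o≡[m+n]⊓o n m o) (cong (_⊓ o) (+-comm n m)))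

sum-merge-counts : ∀ k m cs → length cs ≡ 2 * m → sum (merge-counts k cs) ⊓ k ≡ sum cs ⊓ k
sum-merge-counts k zero    []             _  = refl
sum-merge-counts k (suc m) (c₁ ∷ c₂ ∷ cs) eq = begin
  ((c₁ + c₂) ⊓ k + sum (merge-counts k cs)) ⊓ k      ≡⟨ [m⊓o+n]⊓o≡[m+n]⊓o (c₁ + c₂) _ k ⟩
  ((c₁ + c₂) + sum (merge-counts k cs)) ⊓ k          ≡⟨ [m+n⊓o]⊓o≡[m+n]⊓o (c₁ + c₂) _ k ⟨
  ((c₁ + c₂) + sum (merge-counts k cs) ⊓ k) ⊓ k      ≡⟨ cong (λ x → ((c₁ + c₂) + x) ⊓ k) (sum-merge-counts k m cs |cs|≡2m) ⟩
  ((c₁ + c₂) + sum cs ⊓ k) ⊓ k                       ≡⟨ [m+n⊓o]⊓o≡[m+n]⊓o (c₁ + c₂) _ k ⟩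
  ((c₁ + c₂) + sum cs) ⊓ k                           ≡⟨ cong (_⊓ k) (+-assoc c₁ c₂ (sum cs)) ⟩
  (c₁ + (c₂ + sum cs)) ⊓ k ∎
  where
  open ≡-Reasoning
  |cs|≡2m = suc-injective (suc-injective (trans eq (*-suc 2 m)))
sum-merge-counts k (suc m) []             eq with () ← trans eq (*-suc 2 m)
sum-merge-counts k (suc m) (c ∷ [])       eq with () ← trans eq (*-suc 2 m)

iterateRounds-thermometers : ∀ b r cs → length cs ≡ 2 ^ r → All (_≤ 2 ^ b) cs →
  iterateRounds b r (map (thermometer (2 ^ b)) cs) ≡ thermometer (2 ^ b) (sum cs ⊓ 2 ^ b) ∷ []
iterateRounds-thermometers b zero    (c ∷ []) _ (c≤k ∷ []) =
  cong (λ x → thermometer (2 ^ b) x ∷ []) (sym (trans (cong (_⊓ 2 ^ b) (+-identityʳ c)) (m≤n⇒m⊓n≡m c≤k)))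
iterateRounds-thermometers b (suc r) cs |cs|≡2^r+1 cs≤k = begin
  iterateRounds b r (round b (map (thermometer k) cs))
    ≡⟨ cong (iterateRounds b r) (round-thermometers b cs cs≤k) ⟩
  iterateRounds b r (map (thermometer k) (merge-counts k cs))
    ≡⟨ iterateRounds-thermometers b r (merge-counts k cs)
        (length-merge-counts k (2 ^ r) cs |cs|≡2^r+1) (merge-counts-≤ k cs) ⟩
  thermometer k (sum (merge-counts k cs) ⊓ k) ∷ []
    ≡⟨ cong (λ x → thermometer k x ∷ []) (sum-merge-counts k (2 ^ r) cs |cs|≡2^r+1) ⟩
  thermometer k (sum cs ⊓ k) ∷ [] ∎
  where
  open ≡-Reasoning
  k = 2 ^ b

length-drop-block : ∀ k l (zs : List ℕ) → length zs ≡ suc l * k → length (drop k zs) ≡ l * k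
length-drop-block k l zs |zs| = trans (length-drop k zs) (trans (cong (_∸ k) |zs|) (m+n∸m≡n k _))

blocks-sorted : ∀ b l zs → length zs ≡ l * 2 ^ b → All (_≤ 1) zs →
  map (run (oeSort 0 b)) (blocks (2 ^ b) l zs) ≡ map (thermometer (2 ^ b)) (map sum (blocks (2 ^ b) l zs))
blocks-sorted b zero    zs _    _     = refl
blocks-sorted b (suc l) zs |zs| zs≤1 =
  cong₂ _∷_ (oeSort-thermometer b (take k zs) |take| (Allₚ.take⁺ k zs≤1))
            (blocks-sorted b l (drop k zs) (length-drop-block k l zs |zs|) (Allₚ.drop⁺ k zs≤1))
  where
  k = 2 ^ b
  |take| : length (take k zs) ≡ k
  |take| = trans (length-take k zs) (trans (cong (k ⊓_) |zs|) (m≤n⇒m⊓n≡m (m≤m+n k _)))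

length-blocks : ∀ k l zs → length (blocks k l zs) ≡ l
length-blocks k zero    zs = refl
length-blocks k (suc l) zs = cong suc (length-blocks k l (drop k zs))

block-sums-≤ : ∀ k l {zs} → All (_≤ 1) zs → All (_≤ k) (map sum (blocks k l zs))
block-sums-≤ k zero    zs≤1 = []
block-sums-≤ k (suc l) {zs} zs≤1 =
  ≤-trans (sum≤length (Allₚ.take⁺ k zs≤1)) (≤-trans (≤-reflexive (length-take k zs)) (m⊓n≤m k _))
  ∷ block-sums-≤ k l (Allₚ.drop⁺ k zs≤1)

sum-block-sums : ∀ k l zs → length zs ≡ l * k → sum (map sum (blocks k l zs)) ≡ sum zs
sum-block-sums k zero    []       _    = refl
sum-block-sums k (suc l) zs       |zs| = begin
  sum (take k zs) + sum (map sum (blocks k l (drop k zs)))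
    ≡⟨ cong (sum (take k zs) +_) (sum-block-sums k l (drop k zs) (length-drop-block k l zs |zs|)) ⟩
  sum (take k zs) + sum (drop k zs)
    ≡⟨ sum-++ (take k zs) (drop k zs) ⟨
  sum (take k zs ++ drop k zs)
    ≡⟨ cong sum (take++drop≡id k zs) ⟩
  sum zs ∎
  where open ≡-Reasoning

bitSel-01 : ∀ a b → b ≤ a → ∀ zs → length zs ≡ 2 ^ a → All (_≤ 1) zs →
  bitSel a b zs ≡ thermometer (2 ^ b) (sum zs ⊓ 2 ^ b) ∷ []
bitSel-01 a b b≤a zs |zs| zs≤1 = begin
  iterateRounds b (a ∸ b) (map (run (oeSort 0 b)) Bs)
    ≡⟨ cong (iterateRounds b (a ∸ b)) (blocks-sorted b l zs |zs|≡l*k zs≤1) ⟩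
  iterateRounds b (a ∸ b) (map (thermometer k) (map sum Bs))
    ≡⟨ iterateRounds-thermometers b (a ∸ b) (map sum Bs)
        (trans (length-map sum Bs) (length-blocks k l zs)) (block-sums-≤ k l zs≤1) ⟩
  thermometer k (sum (map sum Bs) ⊓ k) ∷ []
    ≡⟨ cong (λ x → thermometer k (x ⊓ k) ∷ []) (sum-block-sums k l zs |zs|≡l*k) ⟩
  thermometer k (sum zs ⊓ k) ∷ [] ∎
  where
  open ≡-Reasoning
  k = 2 ^ b
  l = 2 ^ (a ∸ b)
  Bs = blocks k l zs
  |zs|≡l*k : length zs ≡ l * k
  |zs|≡l*k = trans |zs| (trans (cong (2 ^_) (sym (m∸n+n≡m b≤a))) (^-distribˡ-+-* 2 (a ∸ b) b))

thresholds-≤1 : ∀ t xs → All (_≤ 1) (map (threshold t) xs)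
thresholds-≤1 t xs = Allₚ.map⁺ (All.universal (λ x → step≤1 x t) xs)

sorted-take-thresholds : ∀ t k ys → Sorted ys → k ≤ length ys →
  map (threshold t) (take k ys) ≡ thermometer k (sum (map (threshold t) ys) ⊓ k)
sorted-take-thresholds t k ys sorted k≤n = begin
  map (threshold t) (take k ys)
    ≡⟨ take-map k ys ⟨
  take k (map (threshold t) ys)
    ≡⟨ cong (take k) (sorted01≡thermometer _ (sorted-map (threshold-mono t) sorted) (thresholds-≤1 t ys)) ⟩
  take k (thermometer (length (map (threshold t) ys)) (sum (map (threshold t) ys)))
    ≡⟨ take-thermometer k _ _ (subst (k ≤_) (sym (length-map _ ys)) k≤n) (sum≤length (thresholds-≤1 t ys)) ⟩
  thermometer k (sum (map (threshold t) ys) ⊓ k) ∎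
  where open ≡-Reasoning

bitSel-thresholds : ∀ a b → b ≤ a → ∀ xs → length xs ≡ 2 ^ a → ∀ t →
  map (map (threshold t)) (bitSel a b xs) ≡ thermometer (2 ^ b) (sum (map (threshold t) xs) ⊓ 2 ^ b) ∷ []
bitSel-thresholds a b b≤a xs |xs| t =
  trans (sym (bitSel-map (threshold-mono t) refl a b xs))
        (bitSel-01 a b b≤a _ (trans (length-map _ xs) |xs|) (thresholds-≤1 t xs))

theorem1 : (a b : ℕ) → b ≤ a → (xs : List ℕ) → length xs ≡ 2 ^ a →
    Σ (List ℕ) (λ B → (bitSel a b xs ≡ B ∷ []) × Sorted B ×
      ((ys : List ℕ) → ys ↭ xs → Sorted ys → B ≡ take (2 ^ b) ys))
theorem1 a b b≤a xs |xs| with bitSel a b xs | bitSel-thresholds a b b≤a xs |xs|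
... | []          | thresholds with () ← thresholds 0
... | _ ∷ _ ∷ _   | thresholds with () ← ∷-injectiveʳ (thresholds 0)
... | B ∷ []      | thresholds = B , refl , B-sorted , B≡top
  where
  count : ℕ → ℕ
  count t = sum (map (threshold t) xs)
  B-thresholds : ∀ t → map (threshold t) B ≡ thermometer (2 ^ b) (count t ⊓ 2 ^ b)
  B-thresholds t = ∷-injectiveˡ (thresholds t)
  B-sorted : Sorted B
  B-sorted = sorted-from-thresholds B λ t →
    subst Sorted (sym (B-thresholds t)) (thermometer-sorted (2 ^ b) (count t ⊓ 2 ^ b))
  B≡top : (ys : List ℕ) → ys ↭ xs → Sorted ys → B ≡ take (2 ^ b) ys
  B≡top ys ys↭xs ys-sorted = map-threshold-injective B (take (2 ^ b) ys) λ t → begin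
    map (threshold t) B
      ≡⟨ B-thresholds t ⟩
    thermometer (2 ^ b) (count t ⊓ 2 ^ b)
      ≡⟨ cong (λ c → thermometer (2 ^ b) (c ⊓ 2 ^ b)) (sum-↭ (↭ₚ.map⁺ (threshold t) ys↭xs)) ⟨
    thermometer (2 ^ b) (sum (map (threshold t) ys) ⊓ 2 ^ b)
      ≡⟨ sorted-take-thresholds t (2 ^ b) ys ys-sorted 2^b≤|ys| ⟨
    map (threshold t) (take (2 ^ b) ys) ∎
    where
    open ≡-Reasoning
    2^b≤|ys| : 2 ^ b ≤ length ys
    2^b≤|ys| = subst (2 ^ b ≤_) (sym (trans (↭ₚ.↭-length ys↭xs) |xs|)) (^-monoʳ-≤ 2 b≤a)
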